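{- Let $S_{l_{1},\ldots,l_{k}}$ denote a spider graph with junction vertex $v$, pendant vertices $u_{1},\ldots,u_{k}$, where $k\geq 2$ and for $i=1,\ldots,k$, the length of the path from $v$ to $u_{i}$ is $l_{i}\geq 1$. Then, the number of minimal forts satisfies \[ \lvert\mathcal{F}_{S_{l_{1},\ldots,l_{k}}}\rvert \leq \binom{k}{2}\lvert\mathcal{F}_{P_{n}}\rvert, \] where $n=\sum_{i=1}^{k}l_{i}+1$ is the order of $S_{l_{1},\ldots,l_{k}}$.
   Context: For a graph $G=(V,E)$, a non-empty subset $F\subseteq V$ is a fort if no vertex outside $F$ has exactly one neighbor in $F$; a fort is minimal if every proper subset is not a fort. $\mathcal{F}_{G}$ denotes the collection of all minimal forts of $G$. $P_{n}$ is the path graph on $n$ vertices. A spider graph is a tree with exactly one junction vertex (vertex of degree at least 3). -}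

module Defs where

open import Data.Bool using (Bool; true; false; _∨_; _∧_)
open import Data.Nat using (ℕ; zero; suc; _+_; _∸_; _≟_)
open import Data.Nat.Properties using () renaming (_≟_ to _≟ℕ_)
open import Data.Fin using (Fin; toℕ)
open import Data.Fin.Subset using (Subset; _∈_; _∉_; _∩_; ∣_∣; Nonempty; _⊂_)
open import Data.Fin.Subset.Properties using (_∈?_; nonempty?; _⊂?_; anySubset?)
open import Data.Fin.Properties using (all?)
open import Data.Vec using (Vec; []; _∷_; tabulate)
open import Data.List using (List; []; _∷_; _++_; length; filter; map)
open import Data.Bool.ListAction using (any)
open import Data.Nat.ListAction using (sum)
open import Data.Product using (_×_; _,_; ∃; proj₁; proj₂)
open import Data.Product.Properties using ()
open import Relation.Nullary using (¬_; Dec; yes; no)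
open import Relation.Nullary.Decidable using (_×-dec_; ¬?; ⌊_⌋)
open import Relation.Binary.PropositionalEquality using (_≡_; _≢_)

-- Simple graphs on the vertex set Fin n, given by a Boolean adjacency
-- function (for the graphs below it is symmetric and irreflexive).

Graph : ℕ → Set
Graph n = Fin n → Fin n → Bool

N : ∀ {n} → Graph n → Fin n → Subset n
N G v = tabulate (G v)

IsFort : ∀ {n} → Graph n → Subset n → Set
IsFort G F = Nonempty F × (∀ v → v ∉ F → ∣ N G v ∩ F ∣ ≢ 1)

IsMinimalFort : ∀ {n} → Graph n → Subset n → Set
IsMinimalFort G F = IsFort G F × (∀ F′ → F′ ⊂ F → ¬ IsFort G F′)

isFort? : ∀ {n} (G : Graph n) (F : Subset n) → Dec (IsFort G F)
isFort? G F = nonempty? F ×-dec all? (λ v → impl? (v ∈? F) (¬? (∣ N G v ∩ F ∣ ≟ℕ 1)))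
  where
  impl? : ∀ {A B : Set} → Dec A → Dec B → Dec (¬ A → B)
  impl? _ (yes b) = yes (λ _ → b)
  impl? (yes a) (no ¬b) = yes (λ na → Data.Empty.⊥-elim (na a))
    where import Data.Empty
  impl? (no ¬a) (no ¬b) = no (λ f → ¬b (f ¬a))

isMinimalFort? : ∀ {n} (G : Graph n) (F : Subset n) → Dec (IsMinimalFort G F)
isMinimalFort? G F with isFort? G F | anySubset? (λ F′ → (F′ ⊂? F) ×-dec isFort? G F′)
... | no ¬f | _ = no (λ m → ¬f (proj₁ m))
... | yes f | yes (F′ , p , q) = no (λ m → proj₂ m F′ p q)
... | yes f | no ¬e = yes (f , λ F′ p q → ¬e (F′ , p , q))

allSubsets : ∀ n → List (Subset n)
allSubsets zero = [] ∷ []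
allSubsets (suc n) = map (true ∷_) (allSubsets n) ++ map (false ∷_) (allSubsets n)

numMinimalForts : ∀ {n} → Graph n → ℕ
numMinimalForts G = length (filter (isMinimalFort? G) (allSubsets _))

-- Concrete graphs, via edge lists on vertex labels 0 … n-1.

edgeIn : List (ℕ × ℕ) → ℕ → ℕ → Bool
edgeIn es a b = any (λ e → (⌊ proj₁ e ≟ℕ a ⌋ ∧ ⌊ proj₂ e ≟ℕ b ⌋)
                         ∨ (⌊ proj₁ e ≟ℕ b ⌋ ∧ ⌊ proj₂ e ≟ℕ a ⌋)) es

fromEdges : ∀ n → List (ℕ × ℕ) → Graph n
fromEdges n es u v = edgeIn es (toℕ u) (toℕ v)

chain : ℕ → ℕ → List (ℕ × ℕ)
chain s zero = []
chain s (suc m) = (s , suc s) ∷ chain (suc s) m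

P : ∀ n → Graph n
P n = fromEdges n (chain 0 (n ∸ 1))

-- Legs of a spider: junction vertex 0; the leg of length l starting after
-- offset `off` is 0 — off+1 — off+2 — … — off+l (its pendant vertex is off+l).
legEdges : ℕ → List ℕ → List (ℕ × ℕ)
legEdges off [] = []
legEdges off (l ∷ ls) = (0 , suc off) ∷ chain (suc off) (l ∸ 1) ++ legEdges (off + l) ls

Spider : (ls : List ℕ) → Graph (suc (sum ls))
Spider ls = fromEdges _ (legEdges 0 ls)

{-# OPTIONS --safe #-}
module Submission where

{-
A subset of the spider is its junction bit followed by the legs, each read from the junction
outwards. It is a fort iff along every leg an outside vertex has both or neither path neighbour
inside, and, if the junction is outside, the number of legs whose first vertex is inside (active
legs) is not 1. A minimal fort has no three consecutive members on a leg (dropping the middle one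
leaves a fort), at most one active leg if the junction is inside, and exactly two if it is outside
(emptying all but two active legs leaves a fort). Leg patterns of this kind obey a transfer
recurrence whose main term is the Padovan sequence, and the patterns without three consecutive
members already give padovan (n - 1) minimal forts of P_n. The count for the spider is at most
C(k,2) padovan (n - 1) because the first two legs form a path through the junction and the Padovan
sequence is monotone and supermultiplicative.
-}

open import Defs
open import Data.Nat
  using ( ℕ; zero; suc; _+_; _*_; _∸_; _⊓_; _≡ᵇ_; _≤_; _<_; z≤n; s≤s; s≤s⁻¹; _≤?_; _<?_
        ; _≤′_; ≤′-refl; ≤′-step )
open import Data.Nat.Properties
open import Data.Nat.Combinatorics using (_C_; nCk+nC[k+1]≡[n+1]C[k+1]; nC1≡n)
open import Data.Nat.ListAction using (sum)
open import Data.Nat.Tactic.RingSolver using (solve-∀)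
open import Data.Bool as Bool using (Bool; true; false; _∧_; _∨_; not; f≤t; b≤b)
open import Data.Bool.Properties
  using ( ∧-assoc; ∧-zeroʳ; ∧-conicalˡ; ∧-conicalʳ; ∧-distribˡ-∨; ∨-assoc; ∨-identityʳ; ∨-zeroʳ
        ; ¬-not; T-≡; T-not-≡; ≤-minimum )
open import Data.Fin using (Fin; toℕ; fromℕ<) renaming (zero to fzero; suc to fsuc)
open import Data.Fin.Properties using (toℕ<n; toℕ-fromℕ<)
open import Data.Fin.Subset using (Subset; _∈_; _∉_; _∩_; ∣_∣; Nonempty; _⊆_; _⊂_)
open import Data.Fin.Subset.Properties using (drop-∷-⊆; ∉⊥; ⊂-irref)
open import Data.Vec using ([]; _∷_; here; there; tabulate; lookup; replicate; take; drop; _++_)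
open import Data.Vec.Properties using (∷-injectiveʳ; []=⇒lookup; lookup⇒[]=; take++drop≡id; ++-injective)
open import Data.Vec.Relation.Binary.Pointwise.Inductive as Pointwise using (Pointwise; []; _∷_)
open import Data.List using (List; []; _∷_; length; filter; map) renaming (_++_ to _++ˡ_)
open import Data.List.Properties using (filter-++; length-++; ++-identityʳ)
open import Data.List.Membership.Propositional using () renaming (_∈_ to _∈ˡ_)
open import Data.List.Relation.Unary.All as All using (All; []; _∷_)
open import Data.List.Relation.Unary.All.Properties as All using ()
open import Data.List.Relation.Unary.Any as Any using ()
open import Data.Product using (_×_; _,_; ∃; proj₁; proj₂)
open import Data.Sum as Sum using (_⊎_; inj₁; inj₂)
open import Data.Unit using (⊤; tt)
open import Function using (_∘_; _⇔_; mk⇔; Equivalence)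
open import Level using (0ℓ)
open import Relation.Nullary using (¬_; Dec; yes; no; does; contradiction)
open import Relation.Nullary.Decidable using (⌊_⌋)
open import Relation.Unary using (Pred; Decidable)
open import Relation.Binary.PropositionalEquality

-- Counting subsets

bit : Bool → ℕ
bit false = 0
bit true  = 1

does⇒ : ∀ {A : Set} (a? : Dec A) → does a? ≡ true → A
does⇒ (yes a) _ = a
does⇒ (no _) ()

does⇐ : ∀ {A : Set} (a? : Dec A) → A → does a? ≡ true
does⇐ (yes _) _ = refl
does⇐ (no ¬a) a = contradiction a ¬a

countSubsets : ∀ n → (Subset n → Bool) → ℕ
countSubsets zero    q = bit (q [])
countSubsets (suc n) q = countSubsets n (λ s → q (true ∷ s)) + countSubsets n (λ s → q (false ∷ s))

length-filter-map : ∀ {A B : Set} {P : Pred B 0ℓ} (P? : Decidable P) (f : A → B) xs →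
  length (filter P? (map f xs)) ≡ length (filter (P? ∘ f) xs)
length-filter-map P? f [] = refl
length-filter-map P? f (x ∷ xs) with does (P? (f x))
... | true  = cong suc (length-filter-map P? f xs)
... | false = length-filter-map P? f xs

length-filter-allSubsets : ∀ n {P : Pred (Subset n) 0ℓ} (P? : Decidable P) →
  length (filter P? (allSubsets n)) ≡ countSubsets n (λ s → does (P? s))
length-filter-allSubsets zero P? with does (P? [])
... | true  = refl
... | false = refl
length-filter-allSubsets (suc n) P? = begin
  length (filter P? (ins ++ˡ outs))
    ≡⟨ cong length (filter-++ P? ins outs) ⟩
  length (filter P? ins ++ˡ filter P? outs)
    ≡⟨ length-++ (filter P? ins) ⟩
  length (filter P? ins) + length (filter P? outs)
    ≡⟨ cong₂ _+_ (length-filter-map P? (true ∷_) ss) (length-filter-map P? (false ∷_) ss) ⟩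
  length (filter (P? ∘ (true ∷_)) ss) + length (filter (P? ∘ (false ∷_)) ss)
    ≡⟨ cong₂ _+_ (length-filter-allSubsets n _) (length-filter-allSubsets n _) ⟩
  countSubsets (suc n) (λ s → does (P? s)) ∎
  where
  open ≡-Reasoning
  ss = allSubsets n
  ins = map (true ∷_) ss
  outs = map (false ∷_) ss

countSubsets-cong : ∀ n {p q : Subset n → Bool} → (∀ s → p s ≡ q s) →
  countSubsets n p ≡ countSubsets n q
countSubsets-cong zero    p≗q = cong bit (p≗q [])
countSubsets-cong (suc n) p≗q =
  cong₂ _+_ (countSubsets-cong n (λ s → p≗q (true ∷ s))) (countSubsets-cong n (λ s → p≗q (false ∷ s)))

countSubsets-mono : ∀ n {p q : Subset n → Bool} → (∀ s → p s ≡ true → q s ≡ true) →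
  countSubsets n p ≤ countSubsets n q
countSubsets-mono zero {p} p⇒q with p [] in eq
... | true  rewrite p⇒q [] eq = ≤-refl
... | false = z≤n
countSubsets-mono (suc n) p⇒q =
  +-mono-≤ (countSubsets-mono n (λ s → p⇒q (true ∷ s))) (countSubsets-mono n (λ s → p⇒q (false ∷ s)))

countSubsets-false : ∀ n → countSubsets n (λ _ → false) ≡ 0
countSubsets-false zero    = refl
countSubsets-false (suc n) = cong₂ _+_ (countSubsets-false n) (countSubsets-false n)

countSubsets-∨ : ∀ n (p q : Subset n → Bool) →
  countSubsets n (λ s → p s ∨ q s) ≤ countSubsets n p + countSubsets n q
countSubsets-∨ zero p q with p []
... | true  = s≤s z≤n
... | false = ≤-refl
countSubsets-∨ (suc n) p q = begin
  countSubsets n (λ s → p (true ∷ s) ∨ q (true ∷ s))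
    + countSubsets n (λ s → p (false ∷ s) ∨ q (false ∷ s))
    ≤⟨ +-mono-≤ (countSubsets-∨ n _ _) (countSubsets-∨ n _ _) ⟩
  (pt + qt) + (pf + qf)
    ≡⟨ +-assoc-swap pt qt pf qf ⟩
  (pt + pf) + (qt + qf) ∎
  where
  open ≤-Reasoning
  pt = countSubsets n (λ s → p (true ∷ s))
  pf = countSubsets n (λ s → p (false ∷ s))
  qt = countSubsets n (λ s → q (true ∷ s))
  qf = countSubsets n (λ s → q (false ∷ s))
  +-assoc-swap : ∀ a b c d → (a + b) + (c + d) ≡ (a + c) + (b + d)
  +-assoc-swap = solve-∀

countSubsets-take-drop : ∀ m n (p : Subset m → Bool) (q : Subset n → Bool) →
  countSubsets (m + n) (λ s → p (take m s) ∧ q (drop m s)) ≡ countSubsets m p * countSubsets n q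
countSubsets-take-drop zero n p q with p []
... | true  = sym (+-identityʳ _)
... | false = countSubsets-false n
countSubsets-take-drop (suc m) n p q = begin
  countSubsets (m + n) (λ s → p (true ∷ take m s) ∧ q (drop m s))
    + countSubsets (m + n) (λ s → p (false ∷ take m s) ∧ q (drop m s))
    ≡⟨ cong₂ _+_ (countSubsets-take-drop m n _ q) (countSubsets-take-drop m n _ q) ⟩
  countSubsets m (λ s → p (true ∷ s)) * countSubsets n q
    + countSubsets m (λ s → p (false ∷ s)) * countSubsets n q
    ≡⟨ *-distribʳ-+ (countSubsets n q) (countSubsets m _) (countSubsets m _) ⟨
  countSubsets (suc m) p * countSubsets n q ∎
  where open ≡-Reasoning

numMinimalForts≤countSubsets : ∀ {n} (G : Graph n) (q : Subset n → Bool) →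
  (∀ F → IsMinimalFort G F → q F ≡ true) → numMinimalForts G ≤ countSubsets n q
numMinimalForts≤countSubsets {n} G q min⇒q = begin
  numMinimalForts G
    ≡⟨ length-filter-allSubsets n (isMinimalFort? G) ⟩
  countSubsets n (λ F → does (isMinimalFort? G F))
    ≤⟨ countSubsets-mono n (λ F m → min⇒q F (does⇒ (isMinimalFort? G F) m)) ⟩
  countSubsets n q ∎
  where open ≤-Reasoning

countSubsets≤numMinimalForts : ∀ {n} (G : Graph n) (q : Subset n → Bool) →
  (∀ F → q F ≡ true → IsMinimalFort G F) → countSubsets n q ≤ numMinimalForts G
countSubsets≤numMinimalForts {n} G q q⇒min = begin
  countSubsets n q
    ≤⟨ countSubsets-mono n (λ F e → does⇐ (isMinimalFort? G F) (q⇒min F e)) ⟩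
  countSubsets n (λ F → does (isMinimalFort? G F))
    ≡⟨ length-filter-allSubsets n (isMinimalFort? G) ⟨
  numMinimalForts G ∎
  where open ≤-Reasoning

pointwise⇒⊆ : ∀ {n} {p q : Subset n} → Pointwise Bool._≤_ p q → p ⊆ q
pointwise⇒⊆ (b≤b ∷ _)  here       = here
pointwise⇒⊆ (_   ∷ ps) (there x∈) = there (pointwise⇒⊆ ps x∈)

⊆⇒pointwise : ∀ {n} {p q : Subset n} → p ⊆ q → Pointwise Bool._≤_ p q
⊆⇒pointwise {p = []}        {[]}    _   = []
⊆⇒pointwise {p = false ∷ _} {t ∷ _} p⊆q = ≤-minimum t ∷ ⊆⇒pointwise (drop-∷-⊆ p⊆q)
⊆⇒pointwise {p = true ∷ _}  {t ∷ _} p⊆q with p⊆q here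
... | here = b≤b ∷ ⊆⇒pointwise (drop-∷-⊆ p⊆q)

pointwise∧≢⇒⊂ : ∀ {n} {p q : Subset n} → Pointwise Bool._≤_ p q → p ≢ q → p ⊂ q
pointwise∧≢⇒⊂ p≤q p≢q = pointwise⇒⊆ p≤q , missing p≤q p≢q
  where
  missing : ∀ {n} {p q : Subset n} → Pointwise Bool._≤_ p q → p ≢ q → ∃ λ x → x ∈ q × x ∉ p
  missing []          p≢q = contradiction refl p≢q
  missing (f≤t ∷ _)   _   = fzero , here , λ ()
  missing (b≤b ∷ p≤q) p≢q with missing p≤q (p≢q ∘ cong (_ ∷_))
  ... | x , x∈q , x∉p = fsuc x , there x∈q , λ { (there x∈p) → x∉p x∈p }

Nonempty-∷ : ∀ {n} s {p : Subset n} → Nonempty p → Nonempty (s ∷ p)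
Nonempty-∷ s (x , x∈p) = fsuc x , there x∈p

Nonempty-++ʳ : ∀ {m n} (p : Subset m) {q : Subset n} → Nonempty q → Nonempty (p ++ q)
Nonempty-++ʳ []      ne = ne
Nonempty-++ʳ (s ∷ p) ne = Nonempty-∷ s (Nonempty-++ʳ p ne)

¬Nonempty-outside∷⊥ : ∀ {n} → ¬ Nonempty (false ∷ replicate n false)
¬Nonempty-outside∷⊥ (fsuc x , there x∈⊥) = ∉⊥ x∈⊥

-- Labels at or beyond the size of the subset read as outside.
at : ∀ {n} → Subset n → ℕ → Bool
at []      _       = false
at (s ∷ p) zero    = s
at (s ∷ p) (suc k) = at p k

at-≥ : ∀ {n} (p : Subset n) {k} → n ≤ k → at p k ≡ false
at-≥ []      _         = refl
at-≥ (s ∷ p) (s≤s n≤k) = at-≥ p n≤k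

at-toℕ : ∀ {n} (p : Subset n) (x : Fin n) → at p (toℕ x) ≡ lookup p x
at-toℕ (s ∷ p) fzero    = refl
at-toℕ (s ∷ p) (fsuc x) = at-toℕ p x

∈⇒at : ∀ {n} {p : Subset n} {x : Fin n} → x ∈ p → at p (toℕ x) ≡ true
∈⇒at {p = p} {x} x∈p = trans (at-toℕ p x) ([]=⇒lookup x∈p)

at⇒∈ : ∀ {n} {p : Subset n} {x : Fin n} → at p (toℕ x) ≡ true → x ∈ p
at⇒∈ {p = p} {x} e = lookup⇒[]= x p (trans (sym (at-toℕ p x)) e)

hits : ∀ {n} → (ℕ → Bool) → Subset n → ℕ
hits g []      = 0
hits g (s ∷ p) = bit (g 0 ∧ s) + hits (g ∘ suc) p

∣tabulate∩∣≡hits : ∀ {n} (g : ℕ → Bool) (p : Subset n) →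
  ∣ tabulate (g ∘ toℕ) ∩ p ∣ ≡ hits g p
∣tabulate∩∣≡hits g []      = refl
∣tabulate∩∣≡hits g (s ∷ p) with g 0 ∧ s
... | true  = cong suc (∣tabulate∩∣≡hits (g ∘ suc) p)
... | false = ∣tabulate∩∣≡hits (g ∘ suc) p

hits-cong : ∀ {n} {g h : ℕ → Bool} (p : Subset n) → (∀ k → g k ≡ h k) → hits g p ≡ hits h p
hits-cong []      g≗h = refl
hits-cong (s ∷ p) g≗h = cong₂ _+_ (cong (λ b → bit (b ∧ s)) (g≗h 0)) (hits-cong p (g≗h ∘ suc))

hits-none : ∀ {n} {g : ℕ → Bool} (p : Subset n) → (∀ k → g k ≡ false) → hits g p ≡ 0
hits-none p g≗∅ = trans (hits-cong p g≗∅) (none p)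
  where
  none : ∀ {n} (p : Subset n) → hits (λ _ → false) p ≡ 0
  none []      = refl
  none (_ ∷ p) = none p

hits-∨ : ∀ {n} {g h : ℕ → Bool} (p : Subset n) → (∀ k → g k ≡ true → h k ≡ false) →
  hits (λ k → g k ∨ h k) p ≡ hits g p + hits h p
hits-∨ [] _ = refl
hits-∨ {g = g} {h} (s ∷ p) disjoint with g 0 in g0 | h 0 in h0
... | true  | true  = contradiction (trans (sym (disjoint 0 g0)) h0) λ ()
... | true  | false = trans (cong (bit s +_) (hits-∨ p (disjoint ∘ suc))) (sym (+-assoc (bit s) _ _))
... | false | b     = trans (cong (bit (b ∧ s) +_) (hits-∨ p (disjoint ∘ suc)))
                            (x+[y+z]≡y+[x+z] (bit (b ∧ s)) (hits (g ∘ suc) p) _)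
  where
  x+[y+z]≡y+[x+z] : ∀ x y z → x + (y + z) ≡ y + (x + z)
  x+[y+z]≡y+[x+z] = solve-∀

hits-single : ∀ {n} {g : ℕ → Bool} (p : Subset n) x →
  (∀ k → g k ≡ true → k ≡ x) → g x ≡ true → hits g p ≡ bit (at p x)
hits-single []              _       _    _  = refl
hits-single {g = g} (s ∷ p) zero    only gx rewrite gx =
  trans (cong (bit s +_) (hits-none p later)) (+-identityʳ _)
  where
  later : ∀ k → g (suc k) ≡ false
  later k = ¬-not (λ e → 0≢1+n (sym (only (suc k) e)))
hits-single {g = g} (s ∷ p) (suc x) only gx rewrite ¬-not {g 0} (λ e → 0≢1+n (only 0 e)) =
  hits-single p x (λ k e → suc-injective (only (suc k) e)) gx

hits-pair : ∀ {n} {g : ℕ → Bool} (p : Subset n) x y → x ≢ y →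
  (∀ k → g k ≡ true → k ≡ x ⊎ k ≡ y) → g x ≡ true → g y ≡ true →
  hits g p ≡ bit (at p x) + bit (at p y)
hits-pair []      _       _       _   _    _  _  = refl
hits-pair (s ∷ p) zero    zero    x≢y _    _  _  = contradiction refl x≢y
hits-pair (s ∷ p) zero    (suc y) _   only gx gy rewrite gx =
  cong (bit s +_) (hits-single p y (λ k e → suc-injective (right (only (suc k) e))) gy)
  where
  right : ∀ {k} → suc k ≡ 0 ⊎ suc k ≡ suc y → suc k ≡ suc y
  right (inj₂ e) = e
hits-pair (s ∷ p) (suc x) zero    _   only gx gy rewrite gy =
  trans (cong (bit s +_) (hits-single p x (λ k e → suc-injective (left (only (suc k) e))) gx)) (+-comm (bit s) _)
  where
  left : ∀ {k} → suc k ≡ suc x ⊎ suc k ≡ 0 → suc k ≡ suc x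
  left (inj₁ e) = e
hits-pair {g = g} (s ∷ p) (suc x) (suc y) x≢y only gx gy
  rewrite ¬-not {g 0} (Sum.[ (λ ()) , (λ ()) ] ∘ only 0) =
  hits-pair p x y (x≢y ∘ cong suc) (λ k e → Sum.map suc-injective suc-injective (only (suc k) e)) gx gy

-- Neighbourhoods in a spider

Joins : ℕ × ℕ → ℕ → ℕ → Set
Joins e a b = (proj₁ e ≡ a × proj₂ e ≡ b) ⊎ (proj₁ e ≡ b × proj₂ e ≡ a)

joins : ℕ × ℕ → ℕ → ℕ → Bool
joins e a b = (⌊ proj₁ e ≟ a ⌋ ∧ ⌊ proj₂ e ≟ b ⌋)
            ∨ (⌊ proj₁ e ≟ b ⌋ ∧ ⌊ proj₂ e ≟ a ⌋)

joins⇒Joins : ∀ e a b → joins e a b ≡ true → Joins e a b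
joins⇒Joins (x , y) a b eq with x ≟ a | y ≟ b | x ≟ b | y ≟ a
... | yes p | yes q | _     | _     = inj₁ (p , q)
... | _     | _     | yes p | yes q = inj₂ (p , q)
... | no _  | _     | no _  | _     = contradiction eq λ ()
... | no _  | _     | yes _ | no _  = contradiction eq λ ()
... | yes _ | no _  | no _  | _     = contradiction eq λ ()
... | yes _ | no _  | yes _ | no _  = contradiction eq λ ()

Joins⇒joins : ∀ e a b → Joins e a b → joins e a b ≡ true
Joins⇒joins (x , y) .x .y (inj₁ (refl , refl)) rewrite ≟-diag {x} refl | ≟-diag {y} refl = refl
Joins⇒joins (x , y) .y .x (inj₂ (refl , refl)) rewrite ≟-diag {x} refl | ≟-diag {y} refl = ∨-zeroʳ _

∨-true : ∀ x {y} → x ∨ y ≡ true → x ≡ true ⊎ y ≡ true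
∨-true true  _  = inj₁ refl
∨-true false eq = inj₂ eq

edgeIn⇒Joins : ∀ es a b → edgeIn es a b ≡ true → ∃ λ e → e ∈ˡ es × Joins e a b
edgeIn⇒Joins (e ∷ es) a b eq with ∨-true (joins e a b) eq
... | inj₁ joined = e , Any.here refl , joins⇒Joins e a b joined
... | inj₂ later with edgeIn⇒Joins es a b later
...   | e′ , e′∈es , J = e′ , Any.there e′∈es , J

Joins⇒edgeIn : ∀ {e} es a b → e ∈ˡ es → Joins e a b → edgeIn es a b ≡ true
Joins⇒edgeIn (e ∷ es) a b (Any.here refl) J = cong (_∨ edgeIn es a b) (Joins⇒joins e a b J)
Joins⇒edgeIn (e ∷ es) a b (Any.there e∈es) J =
  trans (cong (joins e a b ∨_) (Joins⇒edgeIn es a b e∈es J)) (∨-zeroʳ _)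

edgeIn-false : ∀ {P : ℕ × ℕ → Set} es a b → All P es → (∀ {e} → P e → ¬ Joins e a b) →
  edgeIn es a b ≡ false
edgeIn-false es a b all excluded = ¬-not λ eq →
  let e , e∈es , J = edgeIn⇒Joins es a b eq in excluded (All.lookup all e∈es) J

edgeIn-++ : ∀ xs ys a b → edgeIn (xs ++ˡ ys) a b ≡ edgeIn xs a b ∨ edgeIn ys a b
edgeIn-++ []       ys a b = refl
edgeIn-++ (x ∷ xs) ys a b =
  trans (cong (joins x a b ∨_) (edgeIn-++ xs ys a b))
        (sym (∨-assoc (joins x a b) (edgeIn xs a b) (edgeIn ys a b)))

ChainEdge : ℕ → ℕ → ℕ × ℕ → Set
ChainEdge s m (x , y) = s ≤ x × x < s + m × y ≡ suc x

chain-edges : ∀ s m → All (ChainEdge s m) (chain s m)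
chain-edges s zero    = []
chain-edges s (suc m) = (≤-refl , s<s+1+m , refl) ∷ All.map widen (chain-edges (suc s) m)
  where
  s<s+1+m : s < s + suc m
  s<s+1+m = subst (s <_) (sym (+-suc s m)) (s≤s (m≤m+n s m))
  widen : ∀ {e} → ChainEdge (suc s) m e → ChainEdge s (suc m) e
  widen {x , y} (s<x , x<s+m , refl) = <⇒≤ s<x , subst (x <_) (sym (+-suc s m)) x<s+m , refl

chain-Joins : ∀ s m a b → edgeIn (chain s m) a b ≡ true →
  (s ≤ a × a < s + m × b ≡ suc a) ⊎ (s ≤ b × b < s + m × a ≡ suc b)
chain-Joins s m a b eq with edgeIn⇒Joins (chain s m) a b eq
... | e , e∈ , J with All.lookup (chain-edges s m) e∈ | J
...   | s≤x , x<s+m , y≡1+x | inj₁ (refl , refl) = inj₁ (s≤x , x<s+m , y≡1+x)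
...   | s≤x , x<s+m , y≡1+x | inj₂ (refl , refl) = inj₂ (s≤x , x<s+m , y≡1+x)

∈-chain : ∀ s m a → s ≤ a → a < s + m → (a , suc a) ∈ˡ chain s m
∈-chain s zero    a s≤a a<s+0 = contradiction (subst (a <_) (+-identityʳ s) a<s+0) (≤⇒≯ s≤a)
∈-chain s (suc m) a s≤a a<s+m with s ≟ a
... | yes refl = Any.here refl
... | no s≢a   = Any.there (∈-chain (suc s) m a (≤∧≢⇒< s≤a s≢a) (subst (a <_) (+-suc s m) a<s+m))

LegEdge : ℕ → ℕ × ℕ → Set
LegEdge off (x , y) = (x ≡ 0 ⊎ off < x) × off < y

legEdges-edges : ∀ off ls → All (LegEdge off) (legEdges off ls)
legEdges-edges off []       = []
legEdges-edges off (l ∷ ls) =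
  (inj₁ refl , ≤-refl) ∷ All.++⁺ (All.map fromChain (chain-edges (suc off) (l ∸ 1)))
                                 (All.map fromLater (legEdges-edges (off + l) ls))
  where
  fromChain : ∀ {e} → ChainEdge (suc off) (l ∸ 1) e → LegEdge off e
  fromChain {x , y} (off<x , _ , refl) = inj₂ off<x , m<n⇒m<1+n off<x
  fromLater : ∀ {e} → LegEdge (off + l) e → LegEdge off e
  fromLater {x , y} (x-ok , off+l<y) =
    Sum.map₂ (≤-trans (s≤s (m≤m+n off l))) x-ok , ≤-trans (s≤s (m≤m+n off l)) off+l<y

legEdges-from-below : ∀ off ls {a b} → a ≤ off → edgeIn (legEdges off ls) a b ≡ true → a ≡ 0 × off < b
legEdges-from-below off ls {a} {b} a≤off eq with edgeIn⇒Joins (legEdges off ls) a b eq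
... | e , e∈ , J with All.lookup (legEdges-edges off ls) e∈ | J
...   | inj₁ x≡0 , off<y   | inj₁ (refl , refl) = x≡0 , off<y
...   | inj₂ off<x , _     | inj₁ (refl , refl) = contradiction a≤off (<⇒≱ off<x)
...   | _ , off<y          | inj₂ (_ , refl)    = contradiction a≤off (<⇒≱ off<y)

oneLeg : ℕ → ℕ → List (ℕ × ℕ)
oneLeg off l = (0 , suc off) ∷ chain (suc off) (l ∸ 1)

legEdges-∷ : ∀ off l ls a b →
  edgeIn (legEdges off (l ∷ ls)) a b ≡ edgeIn (oneLeg off l) a b ∨ edgeIn (legEdges (off + l) ls) a b
legEdges-∷ off l ls = edgeIn-++ (oneLeg off l) (legEdges (off + l) ls)

oneLeg-bounded : ∀ off l → 1 ≤ l →
  All (λ e → proj₁ e ≤ off + l × proj₂ e ≤ off + l) (oneLeg off l)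
oneLeg-bounded off (suc l) _ =
  (z≤n , off<off+1+l) ∷ All.map inside (chain-edges (suc off) l)
  where
  off<off+1+l : off < off + suc l
  off<off+1+l = subst (off <_) (sym (+-suc off l)) (s≤s (m≤m+n off l))
  inside : ∀ {e} → ChainEdge (suc off) l e → proj₁ e ≤ off + suc l × proj₂ e ≤ off + suc l
  inside {x , y} (_ , x<1+off+l , refl) = <⇒≤ x<off+1+l , x<off+1+l
    where
    x<off+1+l : x < off + suc l
    x<off+1+l = subst (x <_) (sym (+-suc off l)) x<1+off+l

oneLeg-from-junction : ∀ off l u → edgeIn (oneLeg off l) 0 u ≡ true → u ≡ suc off
oneLeg-from-junction off l u eq with ∨-true (joins (0 , suc off) 0 u) eq
... | inj₂ viaChain with chain-Joins (suc off) (l ∸ 1) 0 u viaChain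
...   | inj₁ (() , _)
...   | inj₂ (_ , _ , ())
oneLeg-from-junction off l u eq | inj₁ first with joins⇒Joins (0 , suc off) 0 u first
...   | inj₁ (_ , u≡1+off) = sym u≡1+off
...   | inj₂ (_ , ())

junction-to-oneLeg : ∀ off l → edgeIn (oneLeg off l) 0 (suc off) ≡ true
junction-to-oneLeg off l = Joins⇒edgeIn (oneLeg off l) 0 (suc off) (Any.here refl) (inj₁ (refl , refl))

legHeads : ℕ → List ℕ → (ℕ → Bool) → ℕ
legHeads off []       f = 0
legHeads off (l ∷ ls) f = bit (f (suc off)) + legHeads (off + l) ls f

junction-hits : ∀ off ls {n} (F : Subset n) → All (1 ≤_) ls →
  hits (edgeIn (legEdges off ls) 0) F ≡ legHeads off ls (at F)
junction-hits off []       F _            = hits-none F (λ _ → refl)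
junction-hits off (l ∷ ls) F (1≤l ∷ 1≤ls) = begin
  hits (edgeIn (legEdges off (l ∷ ls)) 0) F
    ≡⟨ hits-cong F (legEdges-∷ off l ls 0) ⟩
  hits (λ u → edgeIn (oneLeg off l) 0 u ∨ edgeIn rest 0 u) F
    ≡⟨ hits-∨ F disjoint ⟩
  hits (edgeIn (oneLeg off l) 0) F + hits (edgeIn rest 0) F
    ≡⟨ cong₂ _+_ (hits-single F (suc off) (oneLeg-from-junction off l) (junction-to-oneLeg off l))
                 (junction-hits (off + l) ls F 1≤ls) ⟩
  legHeads off (l ∷ ls) (at F) ∎
  where
  open ≡-Reasoning
  rest = legEdges (off + l) ls
  1+off≤off+l : suc off ≤ off + l
  1+off≤off+l = subst (_≤ off + l) (+-comm off 1) (+-monoʳ-≤ off 1≤l)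
  disjoint : ∀ u → edgeIn (oneLeg off l) 0 u ≡ true → edgeIn rest 0 u ≡ false
  disjoint u eq = ¬-not λ eq′ →
    <⇒≱ (proj₂ (legEdges-from-below (off + l) ls z≤n eq′))
        (subst (_≤ off + l) (sym (oneLeg-from-junction off l u eq)) 1+off≤off+l)

later-legs-hits : ∀ off l ls a {n} (F : Subset n) → 1 ≤ l → off + l < a →
  hits (edgeIn (legEdges off (l ∷ ls)) a) F ≡ hits (edgeIn (legEdges (off + l) ls) a) F
later-legs-hits off l ls a F 1≤l off+l<a = hits-cong F λ u →
  trans (legEdges-∷ off l ls a u) (cong (_∨ edgeIn (legEdges (off + l) ls) a u)
    (edgeIn-false (oneLeg off l) a u (oneLeg-bounded off l 1≤l)
       λ { (x≤ , _) (inj₁ (refl , _)) → <⇒≱ off+l<a x≤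
         ; (_ , y≤) (inj₂ (_ , refl)) → <⇒≱ off+l<a y≤ }))

prevVertex : ℕ → ℕ → ℕ
prevVertex off zero    = 0
prevVertex off (suc j) = suc (off + j)

nextInLeg : ℕ → ℕ → ℕ → (ℕ → Bool) → Bool
nextInLeg off l j f = ⌊ suc j <? l ⌋ ∧ f (suc (suc (off + j)))

oneLeg-neighbours : ∀ off l j u → j < suc l → edgeIn (oneLeg off (suc l)) (suc (off + j)) u ≡ true →
  u ≡ prevVertex off j ⊎ (suc j < suc l × u ≡ suc (suc (off + j)))
oneLeg-neighbours off l j u j<1+l eq with ∨-true (joins (0 , suc off) (suc (off + j)) u) eq
... | inj₁ first = inj₁ (fromJunctionEdge j (joins⇒Joins (0 , suc off) (suc (off + j)) u first))
  where
  fromJunctionEdge : ∀ j → Joins (0 , suc off) (suc (off + j)) u → u ≡ prevVertex off j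
  fromJunctionEdge zero    (inj₂ (u≡0 , _))    = sym u≡0
  fromJunctionEdge (suc j) (inj₂ (_ , 1+off≡a)) =
    contradiction (suc-injective 1+off≡a) (<⇒≢ (subst (off <_) (sym (+-suc off j)) (s≤s (m≤m+n off j))))
... | inj₂ viaChain = fromChainEdge j (chain-Joins (suc off) l (suc (off + j)) u viaChain)
  where
  fromChainEdge : ∀ j → (suc off ≤ suc (off + j) × suc (off + j) < suc off + l × u ≡ suc (suc (off + j)))
                      ⊎ (suc off ≤ u × u < suc off + l × suc (off + j) ≡ suc u) →
                  u ≡ prevVertex off j ⊎ (suc j < suc l × u ≡ suc (suc (off + j)))
  fromChainEdge j       (inj₁ (_ , a<1+off+l , u≡1+a)) =
    inj₂ (s≤s (+-cancelˡ-< off j l (s≤s⁻¹ a<1+off+l)) , u≡1+a)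
  fromChainEdge zero    (inj₂ (1+off≤u , _ , a≡1+u))   =
    contradiction (subst (suc off ≤_) (trans (sym (suc-injective a≡1+u)) (+-identityʳ off)) 1+off≤u) (n≮n off)
  fromChainEdge (suc j) (inj₂ (_ , _ , a≡1+u))         =
    inj₁ (suc-injective (trans (sym a≡1+u) (cong suc (+-suc off j))))

∈-oneLeg : ∀ off l j → j < l → (suc (off + j) , suc (suc (off + j))) ∈ˡ oneLeg off (suc l)
∈-oneLeg off l j j<l =
  Any.there (∈-chain (suc off) l (suc (off + j)) (s≤s (m≤m+n off j)) (s≤s (+-monoʳ-< off j<l)))

oneLeg-prev : ∀ off l j → j < suc l → edgeIn (oneLeg off (suc l)) (suc (off + j)) (prevVertex off j) ≡ true
oneLeg-prev off l zero    _     =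
  Joins⇒edgeIn (oneLeg off (suc l)) _ _ (Any.here refl) (inj₂ (refl , cong suc (sym (+-identityʳ off))))
oneLeg-prev off l (suc j) j<1+l =
  Joins⇒edgeIn (oneLeg off (suc l)) _ _ (∈-oneLeg off l j (s≤s⁻¹ j<1+l))
               (inj₂ (refl , cong suc (sym (+-suc off j))))

oneLeg-next : ∀ off l j → suc j < suc l →
  edgeIn (oneLeg off (suc l)) (suc (off + j)) (suc (suc (off + j))) ≡ true
oneLeg-next off l j 1+j<1+l =
  Joins⇒edgeIn (oneLeg off (suc l)) _ _ (∈-oneLeg off l j (s≤s⁻¹ 1+j<1+l)) (inj₁ (refl , refl))

leg-vertex-hits : ∀ off l ls j {n} (F : Subset n) → j < l →
  hits (edgeIn (legEdges off (l ∷ ls)) (suc (off + j))) F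
  ≡ bit (at F (prevVertex off j)) + bit (nextInLeg off l j (at F))
leg-vertex-hits off (suc l) ls j F j<1+l = trans (hits-cong F onlyThisLeg) (count (suc j <? suc l))
  where
  a = suc (off + j)
  a≤off+1+l : a ≤ off + suc l
  a≤off+1+l = subst (a ≤_) (sym (+-suc off l)) (s≤s (+-monoʳ-≤ off (s≤s⁻¹ j<1+l)))
  onlyThisLeg : ∀ u → edgeIn (legEdges off (suc l ∷ ls)) a u ≡ edgeIn (oneLeg off (suc l)) a u
  onlyThisLeg u = begin
    edgeIn (legEdges off (suc l ∷ ls)) a u
      ≡⟨ legEdges-∷ off (suc l) ls a u ⟩
    edgeIn (oneLeg off (suc l)) a u ∨ edgeIn (legEdges (off + suc l) ls) a u
      ≡⟨ cong (edgeIn (oneLeg off (suc l)) a u ∨_)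
              (¬-not (1+n≢0 ∘ proj₁ ∘ legEdges-from-below (off + suc l) ls a≤off+1+l)) ⟩
    edgeIn (oneLeg off (suc l)) a u ∨ false
      ≡⟨ ∨-identityʳ _ ⟩
    edgeIn (oneLeg off (suc l)) a u ∎
    where open ≡-Reasoning
  prev<1+a : ∀ j → prevVertex off j < suc (suc (off + j))
  prev<1+a zero    = s≤s z≤n
  prev<1+a (suc j) = s≤s (s≤s (+-monoʳ-≤ off (n≤1+n j)))
  count : (d : Dec (suc j < suc l)) →
    hits (edgeIn (oneLeg off (suc l)) a) F ≡ bit (at F (prevVertex off j)) + bit (⌊ d ⌋ ∧ at F (suc a))
  count (yes 1+j<1+l) = hits-pair F (prevVertex off j) (suc a) (<⇒≢ (prev<1+a j))
    (λ u e → Sum.map₂ proj₂ (oneLeg-neighbours off l j u j<1+l e))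
    (oneLeg-prev off l j j<1+l) (oneLeg-next off l j 1+j<1+l)
  count (no 1+j≮1+l) =
    trans (hits-single F (prevVertex off j) onlyPrev (oneLeg-prev off l j j<1+l)) (sym (+-identityʳ _))
    where
    onlyPrev : ∀ u → edgeIn (oneLeg off (suc l)) a u ≡ true → u ≡ prevVertex off j
    onlyPrev u e = Sum.[ (λ u≡prev → u≡prev) , (λ next → contradiction (proj₁ next) 1+j≮1+l) ]
                       (oneLeg-neighbours off l j u j<1+l e)

-- Forts of spiders and paths

PositionalFort : ∀ {n} → List (ℕ × ℕ) → Subset n → Set
PositionalFort {n} es F = ∀ a → a < n → at F a ≡ false → hits (edgeIn es a) F ≢ 1

fromEdges-fort⇒ : ∀ {n} es (F : Subset n) → IsFort (fromEdges n es) F → PositionalFort es F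
fromEdges-fort⇒ es F (_ , fort) a a<n a∉F hits≡1 =
  fort v v∉F (trans (∣tabulate∩∣≡hits (edgeIn es (toℕ v)) F)
                    (trans (cong (λ k → hits (edgeIn es k) F) toℕv≡a) hits≡1))
  where
  v = fromℕ< a<n
  toℕv≡a = toℕ-fromℕ< a<n
  v∉F : v ∉ F
  v∉F v∈F = contradiction (trans (sym a∉F) (subst (λ k → at F k ≡ true) toℕv≡a (∈⇒at v∈F))) λ ()

fromEdges-fort⇐ : ∀ {n} es (F : Subset n) → Nonempty F → PositionalFort es F → IsFort (fromEdges n es) F
fromEdges-fort⇐ es F nonempty positional = nonempty , λ v v∉F c →
  positional (toℕ v) (toℕ<n v) (¬-not (v∉F ∘ at⇒∈))
             (trans (sym (∣tabulate∩∣≡hits (edgeIn es (toℕ v)) F)) c)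

LegPositional : ℕ → ℕ → (ℕ → Bool) → Set
LegPositional off l f =
  ∀ j → j < l → f (suc (off + j)) ≡ false → bit (f (prevVertex off j)) + bit (nextInLeg off l j f) ≢ 1

LegsPositional : ℕ → List ℕ → (ℕ → Bool) → Set
LegsPositional off []       f = ⊤
LegsPositional off (l ∷ ls) f = LegPositional off l f × LegsPositional (off + l) ls f

LegVertexConditions : ℕ → List ℕ → ∀ {n} → Subset n → Set
LegVertexConditions off ls F =
  ∀ a → off < a → a ≤ off + sum ls → at F a ≡ false → hits (edgeIn (legEdges off ls) a) F ≢ 1

vertex-in-leg : ∀ off l a → off < a → a ≤ off + l → ∃ λ j → j < l × a ≡ suc (off + j)
vertex-in-leg off l (suc a) (s≤s off≤a) 1+a≤off+l =
  a ∸ off ,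
  +-cancelˡ-< off (a ∸ off) l (subst (_< off + l) (sym off+[a∸off]≡a) 1+a≤off+l) ,
  cong suc (sym off+[a∸off]≡a)
  where
  off+[a∸off]≡a = m+[n∸m]≡n off≤a

legVertexConditions⇒legsPositional : ∀ off ls {n} (F : Subset n) → All (1 ≤_) ls →
  LegVertexConditions off ls F → LegsPositional off ls (at F)
legVertexConditions⇒legsPositional off []       F _            _     = tt
legVertexConditions⇒legsPositional off (l ∷ ls) F (1≤l ∷ 1≤ls) conds =
  thisLeg , legVertexConditions⇒legsPositional (off + l) ls F 1≤ls laterLegs
  where
  thisLeg : LegPositional off l (at F)
  thisLeg j j<l j∉F c =
    conds (suc (off + j)) (s≤s (m≤m+n off j)) a≤ j∉F (trans (leg-vertex-hits off l ls j F j<l) c)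
    where
    a≤ : suc (off + j) ≤ off + (l + sum ls)
    a≤ = subst (suc (off + j) ≤_) (+-assoc off l (sum ls))
               (≤-trans (subst (_≤ off + l) (+-suc off j) (+-monoʳ-≤ off j<l)) (m≤m+n (off + l) (sum ls)))
  laterLegs : LegVertexConditions (off + l) ls F
  laterLegs a off+l<a a≤ a∉F c =
    conds a (≤-trans (s≤s (m≤m+n off l)) off+l<a) (subst (a ≤_) (+-assoc off l (sum ls)) a≤) a∉F
          (trans (later-legs-hits off l ls a F 1≤l off+l<a) c)

legsPositional⇒legVertexConditions : ∀ off ls {n} (F : Subset n) → All (1 ≤_) ls →
  LegsPositional off ls (at F) → LegVertexConditions off ls F
legsPositional⇒legVertexConditions off [] F _ _ a off<a a≤off+0 =
  contradiction (subst (a ≤_) (+-identityʳ off) a≤off+0) (<⇒≱ off<a)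
legsPositional⇒legVertexConditions off (l ∷ ls) F (1≤l ∷ 1≤ls) (thisLeg , laterLegs) a off<a a≤ a∉F c
  with a ≤? off + l
... | no a≰off+l = legsPositional⇒legVertexConditions (off + l) ls F 1≤ls laterLegs a (≰⇒> a≰off+l)
                     (subst (a ≤_) (sym (+-assoc off l (sum ls))) a≤) a∉F
                     (trans (sym (later-legs-hits off l ls a F 1≤l (≰⇒> a≰off+l))) c)
... | yes a≤off+l with vertex-in-leg off l a off<a a≤off+l
...   | j , j<l , refl = thisLeg j j<l a∉F (trans (sym (leg-vertex-hits off l ls j F j<l)) c)

SpiderPositional : List ℕ → (ℕ → Bool) → Set
SpiderPositional ls f = (f 0 ≡ false → legHeads 0 ls f ≢ 1) × LegsPositional 0 ls f

spider-positional⇒ : ∀ {n} ls → n ≡ suc (sum ls) → All (1 ≤_) ls → (F : Subset n) →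
  PositionalFort (legEdges 0 ls) F → SpiderPositional ls (at F)
spider-positional⇒ ls n≡ 1≤ls F positional =
  (λ 0∉F c → positional 0 0<n 0∉F (trans (junction-hits 0 ls F 1≤ls) c)) ,
  legVertexConditions⇒legsPositional 0 ls F 1≤ls
    (λ a _ a≤ → positional a (subst (a <_) (sym n≡) (s≤s a≤)))
  where
  0<n = subst (0 <_) (sym n≡) (s≤s z≤n)

spider-positional⇐ : ∀ {n} ls → n ≡ suc (sum ls) → All (1 ≤_) ls → (F : Subset n) →
  SpiderPositional ls (at F) → PositionalFort (legEdges 0 ls) F
spider-positional⇐ ls n≡ 1≤ls F (junction , legs) zero _ 0∉F c =
  junction 0∉F (trans (sym (junction-hits 0 ls F 1≤ls)) c)
spider-positional⇐ ls n≡ 1≤ls F (junction , legs) (suc a) 1+a<n =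
  legsPositional⇒legVertexConditions 0 ls F 1≤ls legs (suc a) (s≤s z≤n)
    (s≤s⁻¹ (subst (suc a <_) n≡ 1+a<n))

agree : Bool → Bool → Bool
agree true  b = b
agree false b = not b

-- p is the vertex before u (the junction, for a leg); an outside vertex needs its two neighbours to
-- agree, the neighbour after the pendant vertex being outside.
legFort : ∀ {n} → Bool → Subset n → Bool
legFort p []      = true
legFort p (q ∷ u) = (q ∨ agree p (at u 0)) ∧ legFort q u

noTriple : ∀ {n} → Bool → Subset n → Bool
noTriple p []      = true
noTriple p (q ∷ u) = not (p ∧ q ∧ at u 0) ∧ noTriple q u

before : ∀ {n} → Bool → Subset n → ℕ → Bool
before p u zero    = p
before p u (suc j) = at u j

LegFortAt : ∀ {n} → Bool → Subset n → Set
LegFortAt {n} p u = ∀ j → j < n → at u j ≡ false → bit (before p u j) + bit (at u (suc j)) ≢ 1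

before-∷ : ∀ {n} p q (u : Subset n) j → before p (q ∷ u) (suc j) ≡ before q u j
before-∷ p q u zero    = refl
before-∷ p q u (suc j) = refl

vertex-condition⇒ : ∀ p q x → (q ∨ agree p x) ≡ true → q ≡ false → bit p + bit x ≢ 1
vertex-condition⇒ true  false true  _ _ ()
vertex-condition⇒ false false false _ _ ()

vertex-condition⇐ : ∀ p q x → (q ≡ false → bit p + bit x ≢ 1) → (q ∨ agree p x) ≡ true
vertex-condition⇐ p     true  x     _    = refl
vertex-condition⇐ true  false true  _    = refl
vertex-condition⇐ true  false false cond = contradiction refl (cond refl)
vertex-condition⇐ false false true  cond = contradiction refl (cond refl)
vertex-condition⇐ false false false _    = refl

legFort⇒LegFortAt : ∀ {n} p (u : Subset n) → legFort p u ≡ true → LegFortAt p u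
legFort⇒LegFortAt p (q ∷ u) fort zero    _     q∉ =
  vertex-condition⇒ p q (at u 0) (∧-conicalˡ _ _ fort) q∉
legFort⇒LegFortAt p (q ∷ u) fort (suc j) 1+j<n j∉ rewrite before-∷ p q u j =
  legFort⇒LegFortAt q u (∧-conicalʳ _ _ fort) j (s≤s⁻¹ 1+j<n) j∉

LegFortAt⇒legFort : ∀ {n} p (u : Subset n) → LegFortAt p u → legFort p u ≡ true
LegFortAt⇒legFort p []      _    = refl
LegFortAt⇒legFort p (q ∷ u) fort = cong₂ _∧_
  (vertex-condition⇐ p q (at u 0) (fort zero (s≤s z≤n)))
  (LegFortAt⇒legFort q u λ j j<n j∉ →
     subst (λ b → bit b + bit (at u (suc j)) ≢ 1) (before-∷ p q u j) (fort (suc j) (s≤s j<n) j∉))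

LegAt : ℕ → ∀ {l} → (ℕ → Bool) → Subset l → Set
LegAt off {l} f u = ∀ k → k < l → f (suc (off + k)) ≡ at u k

leg-vertex-neighbourhood : ∀ off {l} f (u : Subset l) → LegAt off f u → ∀ j → j < l →
  bit (f (prevVertex off j)) + bit (nextInLeg off l j f) ≡ bit (before (f 0) u j) + bit (at u (suc j))
leg-vertex-neighbourhood off {l} f u legAt j j<l = cong₂ _+_ (cong bit (prev j j<l)) (cong bit (next (suc j <? l)))
  where
  prev : ∀ j → j < l → f (prevVertex off j) ≡ before (f 0) u j
  prev zero    _     = refl
  prev (suc j) 1+j<l = legAt j (<⇒≤ 1+j<l)
  next : (d : Dec (suc j < l)) → ⌊ d ⌋ ∧ f (suc (suc (off + j))) ≡ at u (suc j)
  next (yes 1+j<l) = trans (cong (f ∘ suc) (sym (+-suc off j))) (legAt (suc j) 1+j<l)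
  next (no 1+j≮l)  = sym (at-≥ u (≮⇒≥ 1+j≮l))

legPositional⇔LegFortAt : ∀ off {l} f (u : Subset l) → LegAt off f u →
  LegPositional off l f ⇔ LegFortAt (f 0) u
legPositional⇔LegFortAt off f u legAt = mk⇔
  (λ pos j j<l j∉ c → pos j j<l (trans (legAt j j<l) j∉) (trans (local j j<l) c))
  (λ fort j j<l j∉ c → fort j j<l (trans (sym (legAt j j<l)) j∉) (trans (sym (local j j<l)) c))
  where
  local = leg-vertex-neighbourhood off f u legAt

at-take : ∀ m {n} (w : Subset (m + n)) k → k < m → at (take m w) k ≡ at w k
at-take (suc m) (s ∷ w) zero    _     = refl
at-take (suc m) (s ∷ w) (suc k) 1+k<m = at-take m w k (s≤s⁻¹ 1+k<m)

at-drop : ∀ m {n} (w : Subset (m + n)) k → at (drop m w) k ≡ at w (m + k)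
at-drop zero    w       k = refl
at-drop (suc m) (s ∷ w) k = at-drop m w k

legAt-take : ∀ off l {n} f (w : Subset (l + n)) → LegAt off f w → LegAt off f (take l w)
legAt-take off l f w legAt k k<l = trans (legAt k (≤-trans k<l (m≤m+n l _))) (sym (at-take l w k k<l))

legAt-drop : ∀ off l {n} f (w : Subset (l + n)) → LegAt off f w → LegAt (off + l) f (drop l w)
legAt-drop off l f w legAt k k<n =
  trans (cong (f ∘ suc) (+-assoc off l k)) (trans (legAt (l + k) (+-monoʳ-< l k<n)) (sym (at-drop l w k)))

allLegs : (∀ {n} → Subset n → Bool) → (ls : List ℕ) → Subset (sum ls) → Bool
allLegs p []       w = true
allLegs p (l ∷ ls) w = p (take l w) ∧ allLegs p ls (drop l w)

active : (ls : List ℕ) → Subset (sum ls) → ℕ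
active []       w = 0
active (l ∷ ls) w = bit (at (take l w) 0) + active ls (drop l w)

legsPositional⇔allLegsFort : ∀ off ls f (w : Subset (sum ls)) → LegAt off f w →
  LegsPositional off ls f ⇔ (allLegs (legFort (f 0)) ls w ≡ true)
legsPositional⇔allLegsFort off []       f w legAt = mk⇔ (λ _ → refl) (λ _ → tt)
legsPositional⇔allLegsFort off (l ∷ ls) f w legAt = mk⇔
  (λ (this , later) →
     cong₂ _∧_ (LegFortAt⇒legFort (f 0) u (Equivalence.to thisLeg this)) (Equivalence.to laterLegs later))
  (λ fort → Equivalence.from thisLeg (legFort⇒LegFortAt (f 0) u (∧-conicalˡ _ _ fort)) ,
            Equivalence.from laterLegs (∧-conicalʳ _ _ fort))
  where
  u = take l w
  thisLeg = legPositional⇔LegFortAt off f u (legAt-take off l f w legAt)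
  laterLegs = legsPositional⇔allLegsFort (off + l) ls f (drop l w) (legAt-drop off l f w legAt)

legHeads≡active : ∀ off ls f (w : Subset (sum ls)) → All (1 ≤_) ls → LegAt off f w →
  legHeads off ls f ≡ active ls w
legHeads≡active off []           f w _             legAt = refl
legHeads≡active off (suc l ∷ ls) f w (_ ∷ 1≤ls) legAt = cong₂ _+_
  (cong bit (trans (cong (f ∘ suc) (sym (+-identityʳ off))) (legAt-take off (suc l) f w legAt 0 (s≤s z≤n))))
  (legHeads≡active (off + suc l) ls f (drop (suc l) w) 1≤ls (legAt-drop off (suc l) f w legAt))

SpiderFort : Bool → (ls : List ℕ) → Subset (sum ls) → Set
SpiderFort b ls w = Nonempty (b ∷ w) × (b ≡ false → active ls w ≢ 1) × allLegs (legFort b) ls w ≡ true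

spiderFort⇔ : ∀ ls b (w : Subset (sum ls)) → All (1 ≤_) ls →
  IsFort (Spider ls) (b ∷ w) ⇔ SpiderFort b ls w
spiderFort⇔ ls b w 1≤ls = mk⇔
  (λ fort → let junction , legs = spider-positional⇒ ls refl 1≤ls F (fromEdges-fort⇒ (legEdges 0 ls) F fort) in
    proj₁ fort , (λ b∉ → junction b∉ ∘ trans heads≡active) , Equivalence.to legs⇔ legs)
  (λ (nonempty , junction , legs) → fromEdges-fort⇐ (legEdges 0 ls) F nonempty
    (spider-positional⇐ ls refl 1≤ls F
      ((λ b∉ → junction b∉ ∘ trans (sym heads≡active)) , Equivalence.from legs⇔ legs)))
  where
  F = b ∷ w
  legAt : LegAt 0 (at F) w
  legAt _ _ = refl
  heads≡active = legHeads≡active 0 ls (at F) w 1≤ls legAt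
  legs⇔ = legsPositional⇔allLegsFort 0 ls (at F) w legAt

path-as-spider : ∀ L → legEdges 0 (suc L ∷ []) ≡ chain 0 (suc L)
path-as-spider L = cong ((0 , 1) ∷_) (++-identityʳ (chain 1 L))

path-size : ∀ L → suc (suc L) ≡ suc (sum (suc L ∷ []))
path-size L = cong (suc ∘ suc) (sym (+-identityʳ L))

path-fort⇒ : ∀ L b (u : Subset (suc L)) → IsFort (P (suc (suc L))) (b ∷ u) →
  Nonempty (b ∷ u) × (b ≡ false → at u 0 ≡ false) × legFort b u ≡ true
path-fort⇒ L b u fort =
  proj₁ fort ,
  (λ b∉ → ¬-not (λ u₀∈ → junction b∉ (cong (λ x → bit x + 0) u₀∈))) ,
  LegFortAt⇒legFort b u (Equivalence.to (legPositional⇔LegFortAt 0 (at (b ∷ u)) u (λ _ _ → refl)) leg)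
  where
  positional : PositionalFort (legEdges 0 (suc L ∷ [])) (b ∷ u)
  positional = subst (λ es → PositionalFort es (b ∷ u)) (sym (path-as-spider L))
                     (fromEdges-fort⇒ (chain 0 (suc L)) (b ∷ u) fort)
  spider = spider-positional⇒ (suc L ∷ []) (path-size L) (s≤s z≤n ∷ []) (b ∷ u) positional
  junction = proj₁ spider
  leg = proj₁ (proj₂ spider)

path-fort⇐ : ∀ L (u : Subset (suc L)) → legFort true u ≡ true → IsFort (P (suc (suc L))) (true ∷ u)
path-fort⇐ L u fort = fromEdges-fort⇐ (chain 0 (suc L)) (true ∷ u) (fzero , here)
  (subst (λ es → PositionalFort es (true ∷ u)) (path-as-spider L)
    (spider-positional⇐ (suc L ∷ []) (path-size L) (s≤s z≤n ∷ []) (true ∷ u)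
      ((λ ()) , leg , tt)))
  where
  leg = Equivalence.from (legPositional⇔LegFortAt 0 (at (true ∷ u)) u (λ _ _ → refl))
                         (legFort⇒LegFortAt true u fort)

-- Minimal forts

legMinimal : ∀ {n} → Bool → Subset n → Bool
legMinimal p u = legFort p u ∧ noTriple p u

head-mono : ∀ {n} {u′ u : Subset n} → Pointwise Bool._≤_ u′ u → at u′ 0 ≡ true → at u 0 ≡ true
head-mono (b≤b ∷ _) u′₀∈ = u′₀∈
head-mono (f≤t ∷ _) _    = refl

legFort-tail : ∀ {n} p q (u : Subset n) → legFort p (q ∷ u) ≡ true → legFort q u ≡ true
legFort-tail p q u = ∧-conicalʳ (q ∨ agree p (at u 0)) (legFort q u)

noTriple-tail : ∀ {n} p q (u : Subset n) → noTriple p (q ∷ u) ≡ true → noTriple q u ≡ true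
noTriple-tail p q u = ∧-conicalʳ (not (p ∧ q ∧ at u 0)) (noTriple q u)

-- Along a path, a fort without three consecutive members has no proper sub-fort with the same start.
legFort-rigid : ∀ {n} p q {u′ u : Subset n} → Pointwise Bool._≤_ u′ u →
  legFort p (q ∷ u′) ≡ true → legFort p (q ∷ u) ≡ true → noTriple p (q ∷ u) ≡ true → u′ ≡ u
legFort-rigid p q []                                _     _    _          = refl
legFort-rigid p q {x ∷ u′} {_ ∷ u} (b≤b ∷ u′≤u)   fort′ fort tripleFree = cong (x ∷_)
  (legFort-rigid q x u′≤u (legFort-tail p q (x ∷ u′) fort′) (legFort-tail p q (x ∷ u) fort)
                          (noTriple-tail p q (x ∷ u) tripleFree))
legFort-rigid true  false (f≤t ∷ _)               ()    _    _
legFort-rigid false false (f≤t ∷ _)               _     ()   _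
legFort-rigid p true {false ∷ r′} {true ∷ r} (f≤t ∷ r′≤r) fort′ _ tripleFree =
  contradiction (trans (sym (cong not (head-mono r′≤r (∧-conicalˡ (at r′ 0) (legFort false r′) fort′))))
                       (∧-conicalˡ (not (at r 0)) (noTriple true r) (noTriple-tail p true (true ∷ r) tripleFree)))
                λ ()

legFort-outside : ∀ {n} (u : Subset n) → legFort false u ≡ true → at u 0 ≡ false → u ≡ replicate n false
legFort-outside []          _    _  = refl
legFort-outside (false ∷ u) fort _  = cong (false ∷_) (legFort-outside u (∧-conicalʳ _ _ fort) next∉)
  where
  next∉ = Equivalence.to T-not-≡ (Equivalence.from T-≡ (∧-conicalˡ _ _ fort))

legMinimal⇒path-minimalFort : ∀ L (u : Subset (suc L)) → legMinimal true u ≡ true →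
  IsMinimalFort (P (suc (suc L))) (true ∷ u)
legMinimal⇒path-minimalFort L u minimal = path-fort⇐ L u fort , noSmaller
  where
  fort = ∧-conicalˡ _ _ minimal
  noSmaller : ∀ F′ → F′ ⊂ true ∷ u → ¬ IsFort (P (suc (suc L))) F′
  noSmaller (b′ ∷ u′) F′⊂F fort′ with path-fort⇒ L b′ u′ fort′
  ... | nonempty , junction , legFort′ with b′
  ...   | false =
    ¬Nonempty-outside∷⊥ (subst (Nonempty ∘ (false ∷_)) (legFort-outside u′ legFort′ (junction refl)) nonempty)
  ...   | true  = ⊂-irref (cong (true ∷_) u′≡u) F′⊂F
    where
    u′≡u = legFort-rigid false true (⊆⇒pointwise (drop-∷-⊆ (proj₁ F′⊂F))) legFort′ fort
                         (∧-conicalʳ _ _ minimal)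

take-drop-++ : ∀ {m n} (u : Subset m) (v : Subset n) → take m (u ++ v) ≡ u × drop m (u ++ v) ≡ v
take-drop-++ {m} u v = ++-injective (take m (u ++ v)) u (take++drop≡id m (u ++ v))

allLegs-++ : ∀ (p : ∀ {n} → Subset n → Bool) l ls (u : Subset l) (v : Subset (sum ls)) →
  allLegs p (l ∷ ls) (u ++ v) ≡ p u ∧ allLegs p ls v
allLegs-++ p l ls u v rewrite proj₁ (take-drop-++ u v) | proj₂ (take-drop-++ u v) = refl

active-++ : ∀ l ls (u : Subset l) (v : Subset (sum ls)) →
  active (l ∷ ls) (u ++ v) ≡ bit (at u 0) + active ls v
active-++ l ls u v rewrite proj₁ (take-drop-++ u v) | proj₂ (take-drop-++ u v) = refl

at-replicate : ∀ n k → at (replicate n false) k ≡ false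
at-replicate zero    k       = refl
at-replicate (suc n) zero    = refl
at-replicate (suc n) (suc k) = at-replicate n k

replicate-++ : ∀ m n → replicate m false ++ replicate n false ≡ replicate (m + n) false
replicate-++ zero    n = refl
replicate-++ (suc m) n = cong (false ∷_) (replicate-++ m n)

replicate-≤ : ∀ {n} (u : Subset n) → Pointwise Bool._≤_ (replicate n false) u
replicate-≤ []      = []
replicate-≤ (s ∷ u) = ≤-minimum s ∷ replicate-≤ u

legFort-replicate : ∀ n → legFort false (replicate n false) ≡ true
legFort-replicate zero    = refl
legFort-replicate (suc n) rewrite at-replicate n 0 = legFort-replicate n

allLegs-outside : ∀ ls (w : Subset (sum ls)) → allLegs (legFort false) ls w ≡ true → active ls w ≡ 0 →
  w ≡ replicate (sum ls) false
allLegs-outside []       []  _    _ = refl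
allLegs-outside (l ∷ ls) w fort a≡0 with at (take l w) 0 in head
... | false = begin
  w
    ≡⟨ take++drop≡id l w ⟨
  take l w ++ drop l w
    ≡⟨ cong₂ _++_ (legFort-outside (take l w) (∧-conicalˡ _ _ fort) head)
                  (allLegs-outside ls (drop l w) (∧-conicalʳ _ _ fort) a≡0) ⟩
  replicate l false ++ replicate (sum ls) false
    ≡⟨ replicate-++ l (sum ls) ⟩
  replicate (l + sum ls) false ∎
  where open ≡-Reasoning

active≢0⇒Nonempty : ∀ ls (w : Subset (sum ls)) → active ls w ≢ 0 → Nonempty w
active≢0⇒Nonempty []           w       a≢0 = contradiction refl a≢0
active≢0⇒Nonempty (zero ∷ ls)  w       a≢0 = active≢0⇒Nonempty ls w a≢0
active≢0⇒Nonempty (suc l ∷ ls) (true ∷ w)  _   = fzero , here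
active≢0⇒Nonempty (suc l ∷ ls) (false ∷ w) a≢0 =
  Nonempty-∷ false (subst Nonempty (take++drop≡id l w)
                          (Nonempty-++ʳ (take l w) (active≢0⇒Nonempty ls (drop l w) a≢0)))

mapLegs : (∀ {n} → Subset n → Subset n) → (ls : List ℕ) → Subset (sum ls) → Subset (sum ls)
mapLegs f []       w = w
mapLegs f (l ∷ ls) w = f (take l w) ++ mapLegs f ls (drop l w)

mapLegs-≤ : ∀ (f : ∀ {n} → Subset n → Subset n) →
  (∀ {n} (u : Subset n) → Pointwise Bool._≤_ (f u) u) →
  ∀ ls (w : Subset (sum ls)) → Pointwise Bool._≤_ (mapLegs f ls w) w
mapLegs-≤ f f≤ []       w = Pointwise.refl b≤b
mapLegs-≤ f f≤ (l ∷ ls) w =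
  subst (Pointwise Bool._≤_ _) (take++drop≡id l w)
        (Pointwise.++⁺ (f≤ (take l w)) (mapLegs-≤ f f≤ ls (drop l w)))

mapLegs-≢ : ∀ (f : ∀ {n} → Subset n → Subset n) (p : ∀ {n} → Subset n → Bool) →
  (∀ {n} (u : Subset n) → p u ≡ false → f u ≢ u) →
  ∀ ls (w : Subset (sum ls)) → allLegs p ls w ≡ false → mapLegs f ls w ≢ w
mapLegs-≢ f p moved (l ∷ ls) w notAll fixed with p (take l w) in e
... | false = moved (take l w) e (proj₁ pieces)
  where pieces = ++-injective _ _ (trans fixed (sym (take++drop≡id l w)))
... | true  = mapLegs-≢ f p moved ls (drop l w) notAll (proj₂ pieces)
  where pieces = ++-injective _ _ (trans fixed (sym (take++drop≡id l w)))

allLegs-mapLegs : ∀ (f : ∀ {n} → Subset n → Subset n) (p : ∀ {n} → Subset n → Bool) →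
  (∀ {n} (u : Subset n) → p u ≡ true → p (f u) ≡ true) →
  ∀ ls (w : Subset (sum ls)) → allLegs p ls w ≡ true → allLegs p ls (mapLegs f ls w) ≡ true
allLegs-mapLegs f p keeps []       w all = all
allLegs-mapLegs f p keeps (l ∷ ls) w all rewrite allLegs-++ p l ls (f (take l w)) (mapLegs f ls (drop l w)) =
  cong₂ _∧_ (keeps (take l w) (∧-conicalˡ _ _ all))
            (allLegs-mapLegs f p keeps ls (drop l w) (∧-conicalʳ _ _ all))

allLegs-∧ : ∀ (p q : ∀ {n} → Subset n → Bool) ls (w : Subset (sum ls)) →
  allLegs p ls w ≡ true → allLegs q ls w ≡ true → allLegs (λ u → p u ∧ q u) ls w ≡ true
allLegs-∧ p q []       w _    _    = refl
allLegs-∧ p q (l ∷ ls) w allp allq = cong₂ _∧_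
  (cong₂ _∧_ (∧-conicalˡ (p u) (allLegs p ls v) allp) (∧-conicalˡ (q u) (allLegs q ls v) allq))
  (allLegs-∧ p q ls v (∧-conicalʳ (p u) (allLegs p ls v) allp) (∧-conicalʳ (q u) (allLegs q ls v) allq))
  where
  u = take l w
  v = drop l w

active-mapLegs : ∀ (f : ∀ {n} → Subset n → Subset n) →
  (∀ {n} (u : Subset n) → at (f u) 0 ≡ at u 0) →
  ∀ ls (w : Subset (sum ls)) → active ls (mapLegs f ls w) ≡ active ls w
active-mapLegs f sameHead []       w = refl
active-mapLegs f sameHead (l ∷ ls) w rewrite active-++ l ls (f (take l w)) (mapLegs f ls (drop l w)) =
  cong₂ _+_ (cong bit (sameHead (take l w))) (active-mapLegs f sameHead ls (drop l w))

breakTriple : ∀ {n} → Bool → Subset n → Subset n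
breakTriple p     []                 = []
breakTriple false (q ∷ u)            = q ∷ breakTriple q u
breakTriple true  (false ∷ u)        = false ∷ breakTriple false u
breakTriple true  (true ∷ [])        = true ∷ []
breakTriple true  (true ∷ false ∷ u) = true ∷ breakTriple true (false ∷ u)
breakTriple true  (true ∷ true ∷ u)  = false ∷ true ∷ u

breakTriple-head : ∀ {n} (u : Subset n) → at (breakTriple false u) 0 ≡ at u 0
breakTriple-head []      = refl
breakTriple-head (q ∷ u) = refl

breakTriple-≤ : ∀ {n} p (u : Subset n) → Pointwise Bool._≤_ (breakTriple p u) u
breakTriple-≤ p     []                 = []
breakTriple-≤ false (q ∷ u)            = b≤b ∷ breakTriple-≤ q u
breakTriple-≤ true  (false ∷ u)        = b≤b ∷ breakTriple-≤ false u
breakTriple-≤ true  (true ∷ [])        = b≤b ∷ []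
breakTriple-≤ true  (true ∷ false ∷ u) = b≤b ∷ breakTriple-≤ true (false ∷ u)
breakTriple-≤ true  (true ∷ true ∷ u)  = f≤t ∷ Pointwise.refl b≤b

breakTriple-≢ : ∀ {n} p (u : Subset n) → noTriple p u ≡ false → breakTriple p u ≢ u
breakTriple-≢ false (q ∷ u)            triple = breakTriple-≢ q u triple ∘ ∷-injectiveʳ
breakTriple-≢ true  (false ∷ u)        triple = breakTriple-≢ false u triple ∘ ∷-injectiveʳ
breakTriple-≢ true  (true ∷ false ∷ u) triple = breakTriple-≢ true (false ∷ u) triple ∘ ∷-injectiveʳ
breakTriple-≢ true  (true ∷ true ∷ u)  _      = λ ()

breakTriple-legFort : ∀ {n} p (u : Subset n) → legFort p u ≡ true → legFort p (breakTriple p u) ≡ true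
breakTriple-legFort p     []                 fort = fort
breakTriple-legFort false (true ∷ u)         fort = breakTriple-legFort true u fort
breakTriple-legFort false (false ∷ u)        fort = cong₂ _∧_
  (trans (cong not (breakTriple-head u)) (∧-conicalˡ (not (at u 0)) (legFort false u) fort))
  (breakTriple-legFort false u (∧-conicalʳ (not (at u 0)) (legFort false u) fort))
breakTriple-legFort true  (false ∷ u)        fort = cong₂ _∧_
  (trans (breakTriple-head u) (∧-conicalˡ (at u 0) (legFort false u) fort))
  (breakTriple-legFort false u (∧-conicalʳ (at u 0) (legFort false u) fort))
breakTriple-legFort true  (true ∷ [])        fort = fort
breakTriple-legFort true  (true ∷ false ∷ u) fort = breakTriple-legFort true (false ∷ u) fort
breakTriple-legFort true  (true ∷ true ∷ u)  fort = fort

keepActive : ℕ → (ls : List ℕ) → Subset (sum ls) → Subset (sum ls)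
keepActive c       []       w = w
keepActive zero    (l ∷ ls) w = replicate l false ++ keepActive zero ls (drop l w)
keepActive (suc c) (l ∷ ls) w with at (take l w) 0
... | true  = take l w ++ keepActive c ls (drop l w)
... | false = replicate l false ++ keepActive (suc c) ls (drop l w)

keepActive-≤ : ∀ c ls (w : Subset (sum ls)) → Pointwise Bool._≤_ (keepActive c ls w) w
keepActive-≤ c       []       w = Pointwise.refl b≤b
keepActive-≤ zero    (l ∷ ls) w =
  subst (Pointwise Bool._≤_ _) (take++drop≡id l w)
        (Pointwise.++⁺ (replicate-≤ (take l w)) (keepActive-≤ zero ls (drop l w)))
keepActive-≤ (suc c) (l ∷ ls) w with at (take l w) 0
... | true  = subst (Pointwise Bool._≤_ _) (take++drop≡id l w)
                    (Pointwise.++⁺ (Pointwise.refl b≤b) (keepActive-≤ c ls (drop l w)))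
... | false = subst (Pointwise Bool._≤_ _) (take++drop≡id l w)
                    (Pointwise.++⁺ (replicate-≤ (take l w)) (keepActive-≤ (suc c) ls (drop l w)))

keepActive-active : ∀ c ls (w : Subset (sum ls)) → active ls (keepActive c ls w) ≡ active ls w ⊓ c
keepActive-active c       []       w = refl
keepActive-active zero    (l ∷ ls) w
  rewrite active-++ l ls (replicate l false) (keepActive zero ls (drop l w)) | at-replicate l 0
  = trans (keepActive-active zero ls (drop l w))
          (trans (⊓-zeroʳ (active ls (drop l w))) (sym (⊓-zeroʳ (active (l ∷ ls) w))))
keepActive-active (suc c) (l ∷ ls) w with at (take l w) 0 in head
... | true  rewrite active-++ l ls (take l w) (keepActive c ls (drop l w)) | head =
  cong suc (keepActive-active c ls (drop l w))
... | false rewrite active-++ l ls (replicate l false) (keepActive (suc c) ls (drop l w)) | at-replicate l 0 =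
  keepActive-active (suc c) ls (drop l w)

legFort-head : ∀ {n} p (u : Subset n) → at u 0 ≡ true → legFort p u ≡ legFort false u
legFort-head p (true ∷ u) _ = refl

keepActive-legFort : ∀ b c ls (w : Subset (sum ls)) → allLegs (legFort b) ls w ≡ true →
  allLegs (legFort false) ls (keepActive c ls w) ≡ true
keepActive-legFort b c       []       w fort = fort
keepActive-legFort b zero    (l ∷ ls) w fort
  rewrite allLegs-++ (legFort false) l ls (replicate l false) (keepActive zero ls (drop l w)) =
  cong₂ _∧_ (legFort-replicate l) (keepActive-legFort b zero ls (drop l w) (∧-conicalʳ _ _ fort))
keepActive-legFort b (suc c) (l ∷ ls) w fort with at (take l w) 0 in head
... | true rewrite allLegs-++ (legFort false) l ls (take l w) (keepActive c ls (drop l w)) =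
  cong₂ _∧_ (trans (sym (legFort-head b (take l w) head)) (∧-conicalˡ _ _ fort))
            (keepActive-legFort b c ls (drop l w) (∧-conicalʳ _ _ fort))
... | false rewrite allLegs-++ (legFort false) l ls (replicate l false) (keepActive (suc c) ls (drop l w)) =
  cong₂ _∧_ (legFort-replicate l) (keepActive-legFort b (suc c) ls (drop l w) (∧-conicalʳ _ _ fort))

junctionOut-active≢0 : ∀ ls (w : Subset (sum ls)) → Nonempty (false ∷ w) →
  allLegs (legFort false) ls w ≡ true → active ls w ≢ 0
junctionOut-active≢0 ls w nonempty fort a≡0 =
  ¬Nonempty-outside∷⊥ (subst (Nonempty ∘ (false ∷_)) (allLegs-outside ls w fort a≡0) nonempty)

spiderFort-from-legs : ∀ ls b (w : Subset (sum ls)) → All (1 ≤_) ls →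
  (b ≡ false → active ls w ≢ 0) → (b ≡ false → active ls w ≢ 1) → allLegs (legFort b) ls w ≡ true →
  IsFort (Spider ls) (b ∷ w)
spiderFort-from-legs ls b w 1≤ls a≢0 a≢1 legs =
  Equivalence.from (spiderFort⇔ ls b w 1≤ls) (nonempty b a≢0 , a≢1 , legs)
  where
  nonempty : ∀ b → (b ≡ false → active ls w ≢ 0) → Nonempty (b ∷ w)
  nonempty true  _   = fzero , here
  nonempty false a≢0 = Nonempty-∷ false (active≢0⇒Nonempty ls w (a≢0 refl))

breakTriples-fort : ∀ ls b (w : Subset (sum ls)) → All (1 ≤_) ls → SpiderFort b ls w →
  IsFort (Spider ls) (b ∷ mapLegs (breakTriple b) ls w)
breakTriples-fort ls true  w 1≤ls (_ , _ , legs) = spiderFort-from-legs ls true _ 1≤ls (λ ()) (λ ())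
  (allLegs-mapLegs (breakTriple true) (legFort true) (breakTriple-legFort true) ls w legs)
breakTriples-fort ls false w 1≤ls (nonempty , junction , legs) = spiderFort-from-legs ls false _ 1≤ls
  (λ _ → subst (_≢ 0) (sym sameActive) (junctionOut-active≢0 ls w nonempty legs))
  (λ _ → subst (_≢ 1) (sym sameActive) (junction refl))
  (allLegs-mapLegs (breakTriple false) (legFort false) (breakTriple-legFort false) ls w legs)
  where
  sameActive = active-mapLegs (breakTriple false) breakTriple-head ls w

minimalFort⇒noTriple : ∀ ls b (w : Subset (sum ls)) → All (1 ≤_) ls → IsMinimalFort (Spider ls) (b ∷ w) →
  allLegs (noTriple b) ls w ≡ true
minimalFort⇒noTriple ls b w 1≤ls (fort , minimal) with allLegs (noTriple b) ls w in triple
... | true  = refl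
... | false = contradiction (breakTriples-fort ls b w 1≤ls (Equivalence.to (spiderFort⇔ ls b w 1≤ls) fort))
                            (minimal (b ∷ mapLegs (breakTriple b) ls w) smaller)
  where
  smaller = pointwise∧≢⇒⊂ (b≤b ∷ mapLegs-≤ (breakTriple b) (breakTriple-≤ b) ls w)
                          (mapLegs-≢ (breakTriple b) (noTriple b) (breakTriple-≢ b) ls w triple ∘ ∷-injectiveʳ)

keepTwo-active : ∀ ls (w : Subset (sum ls)) → 2 ≤ active ls w → active ls (keepActive 2 ls w) ≡ 2
keepTwo-active ls w 2≤a = trans (keepActive-active 2 ls w) (m≥n⇒m⊓n≡n 2≤a)

keepTwo-fort : ∀ ls b (w : Subset (sum ls)) → All (1 ≤_) ls →
  allLegs (legFort b) ls w ≡ true → 2 ≤ active ls w → IsFort (Spider ls) (false ∷ keepActive 2 ls w)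
keepTwo-fort ls b w 1≤ls legs 2≤a = spiderFort-from-legs ls false (keepActive 2 ls w) 1≤ls
  (λ _ → subst (_≢ 0) (sym (keepTwo-active ls w 2≤a)) λ ())
  (λ _ → subst (_≢ 1) (sym (keepTwo-active ls w 2≤a)) λ ())
  (keepActive-legFort b 2 ls w legs)

minimalFort-junctionIn : ∀ ls (w : Subset (sum ls)) → All (1 ≤_) ls →
  IsMinimalFort (Spider ls) (true ∷ w) → active ls w ≤ 1
minimalFort-junctionIn ls w 1≤ls (fort , minimal) with 2 ≤? active ls w
... | no  2≰a = ≤-pred (≰⇒> 2≰a)
... | yes 2≤a = contradiction (keepTwo-fort ls true w 1≤ls legs 2≤a)
                              (minimal (false ∷ keepActive 2 ls w) smaller)
  where
  legs = proj₂ (proj₂ (Equivalence.to (spiderFort⇔ ls true w 1≤ls) fort))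
  smaller = pointwise∧≢⇒⊂ (f≤t ∷ keepActive-≤ 2 ls w) λ ()

minimalFort-junctionOut : ∀ ls (w : Subset (sum ls)) → All (1 ≤_) ls →
  IsMinimalFort (Spider ls) (false ∷ w) → active ls w ≡ 2
minimalFort-junctionOut ls w 1≤ls (fort , minimal)
  with Equivalence.to (spiderFort⇔ ls false w 1≤ls) fort | active ls w in a
... | nonempty , _        , legs | 0 = contradiction a (junctionOut-active≢0 ls w nonempty legs)
... | _        , junction , _    | 1 = contradiction a (junction refl)
... | _        , _        , _    | 2 = refl
... | _        , _        , legs | suc (suc (suc m)) =
  contradiction (keepTwo-fort ls false w 1≤ls legs 2≤a)
                (minimal (false ∷ keepActive 2 ls w) (pointwise∧≢⇒⊂ (b≤b ∷ keepActive-≤ 2 ls w) kept≢w))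
  where
  2≤a : 2 ≤ active ls w
  2≤a = subst (2 ≤_) (sym a) (s≤s (s≤s z≤n))
  kept≢w : false ∷ keepActive 2 ls w ≢ false ∷ w
  kept≢w eq = contradiction (trans (sym (keepTwo-active ls w 2≤a)) (trans (cong (active ls) (∷-injectiveʳ eq)) a))
                            λ ()

minimalFort⇒legsMinimal : ∀ ls b (w : Subset (sum ls)) → All (1 ≤_) ls → IsMinimalFort (Spider ls) (b ∷ w) →
  allLegs (legMinimal b) ls w ≡ true
minimalFort⇒legsMinimal ls b w 1≤ls minimal = allLegs-∧ (legFort b) (noTriple b) ls w
  (proj₂ (proj₂ (Equivalence.to (spiderFort⇔ ls b w 1≤ls) (proj₁ minimal))))
  (minimalFort⇒noTriple ls b w 1≤ls minimal)

-- Counting leg patterns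

-- The number of legMinimal legs of n + 1 vertices with first vertex q behind a junction p (see
-- countSubsets-legMinimal); the recurrence conditions on the second vertex.
legPatterns : Bool → Bool → ℕ → ℕ
legPatterns p     q     zero    = bit (q ∨ not p)
legPatterns false true  (suc n) = legPatterns true true n + legPatterns true false n
legPatterns true  true  (suc n) = legPatterns true false n
legPatterns true  false (suc n) = legPatterns false true n
legPatterns false false (suc n) = legPatterns false false n

padovan : ℕ → ℕ
padovan = legPatterns false true

countSubsets-∧-false : ∀ n (p : Subset n → Bool) → countSubsets n (λ u → p u ∧ false) ≡ 0
countSubsets-∧-false n p = trans (countSubsets-cong n (λ u → ∧-zeroʳ (p u))) (countSubsets-false n)

countSubsets-legMinimal : ∀ p q n → countSubsets n (λ u → legMinimal p (q ∷ u)) ≡ legPatterns p q n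
countSubsets-legMinimal false true  zero = refl
countSubsets-legMinimal true  true  zero = refl
countSubsets-legMinimal true  false zero = refl
countSubsets-legMinimal false false zero = refl
countSubsets-legMinimal false true  (suc n) =
  cong₂ _+_ (countSubsets-legMinimal true true n) (countSubsets-legMinimal true false n)
countSubsets-legMinimal true  true  (suc n) =
  cong₂ _+_ (countSubsets-∧-false n (λ u → legFort true (true ∷ u))) (countSubsets-legMinimal true false n)
countSubsets-legMinimal true  false (suc n) =
  trans (cong₂ _+_ (countSubsets-legMinimal false true n) (countSubsets-false n)) (+-identityʳ _)
countSubsets-legMinimal false false (suc n) =
  cong₂ _+_ (countSubsets-false n) (countSubsets-legMinimal false false n)

activeCount : Bool → ℕ → List ℕ → ℕ
activeCount b c       []       = bit (0 ≡ᵇ c)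
activeCount b zero    (l ∷ ls) = legPatterns b false (l ∸ 1) * activeCount b zero ls
activeCount b (suc c) (l ∷ ls) =
  legPatterns b true (l ∸ 1) * activeCount b c ls + legPatterns b false (l ∸ 1) * activeCount b (suc c) ls

countSubsets-firstLeg : ∀ b x l ls (g : Subset (sum ls) → Bool) → let legs = allLegs (legMinimal b) ls in
  countSubsets (l + sum ls) (λ w → (legMinimal b (x ∷ take l w) ∧ legs (drop l w)) ∧ g (drop l w))
  ≡ legPatterns b x l * countSubsets (sum ls) (λ v → legs v ∧ g v)
countSubsets-firstLeg b x l ls g = begin
  countSubsets (l + sum ls) (λ w → (legMinimal b (x ∷ take l w) ∧ legs (drop l w)) ∧ g (drop l w))
    ≡⟨ countSubsets-cong (l + sum ls) (λ w → ∧-assoc (legMinimal b (x ∷ take l w)) _ _) ⟩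
  countSubsets (l + sum ls) (λ w → legMinimal b (x ∷ take l w) ∧ (legs (drop l w) ∧ g (drop l w)))
    ≡⟨ countSubsets-take-drop l (sum ls) (λ u → legMinimal b (x ∷ u)) (λ v → legs v ∧ g v) ⟩
  countSubsets l (λ u → legMinimal b (x ∷ u)) * countSubsets (sum ls) (λ v → legs v ∧ g v)
    ≡⟨ cong (_* countSubsets (sum ls) (λ v → legs v ∧ g v)) (countSubsets-legMinimal b x l) ⟩
  legPatterns b x l * countSubsets (sum ls) (λ v → legs v ∧ g v) ∎
  where
  open ≡-Reasoning
  legs = allLegs (legMinimal b) ls

countSubsets-active : ∀ b c ls → All (1 ≤_) ls →
  countSubsets (sum ls) (λ w → allLegs (legMinimal b) ls w ∧ (active ls w ≡ᵇ c)) ≡ activeCount b c ls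
countSubsets-active b c       []           _          = refl
countSubsets-active b zero    (suc l ∷ ls) (_ ∷ 1≤ls) = begin
  countSubsets (sum (suc l ∷ ls)) (λ w → allLegs (legMinimal b) (suc l ∷ ls) w ∧ (active (suc l ∷ ls) w ≡ᵇ 0))
    ≡⟨ cong₂ _+_ (countSubsets-firstLeg b true l ls (λ _ → false))
                 (countSubsets-firstLeg b false l ls (λ v → active ls v ≡ᵇ 0)) ⟩
  legPatterns b true l * countSubsets (sum ls) (λ v → allLegs (legMinimal b) ls v ∧ false)
    + legPatterns b false l * countSubsets (sum ls) (λ v → allLegs (legMinimal b) ls v ∧ (active ls v ≡ᵇ 0))
    ≡⟨ cong₂ (λ x y → legPatterns b true l * x + legPatterns b false l * y)
             (countSubsets-∧-false (sum ls) (allLegs (legMinimal b) ls)) (countSubsets-active b zero ls 1≤ls) ⟩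
  legPatterns b true l * 0 + legPatterns b false l * activeCount b zero ls
    ≡⟨ cong (_+ legPatterns b false l * activeCount b zero ls) (*-zeroʳ (legPatterns b true l)) ⟩
  activeCount b zero (suc l ∷ ls) ∎
  where open ≡-Reasoning
countSubsets-active b (suc c) (suc l ∷ ls) (_ ∷ 1≤ls) = cong₂ _+_
  (trans (countSubsets-firstLeg b true l ls (λ v → active ls v ≡ᵇ c))
         (cong (legPatterns b true l *_) (countSubsets-active b c ls 1≤ls)))
  (trans (countSubsets-firstLeg b false l ls (λ v → active ls v ≡ᵇ suc c))
         (cong (legPatterns b false l *_) (countSubsets-active b (suc c) ls 1≤ls)))

spiderCandidate : (ls : List ℕ) → Subset (suc (sum ls)) → Bool
spiderCandidate ls (true  ∷ w) = allLegs (legMinimal true) ls w ∧ ((active ls w ≡ᵇ 0) ∨ (active ls w ≡ᵇ 1))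
spiderCandidate ls (false ∷ w) = allLegs (legMinimal false) ls w ∧ (active ls w ≡ᵇ 2)

minimalFort⇒spiderCandidate : ∀ ls → All (1 ≤_) ls → ∀ F → IsMinimalFort (Spider ls) F →
  spiderCandidate ls F ≡ true
minimalFort⇒spiderCandidate ls 1≤ls (true ∷ w) minimal
  with active ls w | minimalFort-junctionIn ls w 1≤ls minimal | minimalFort⇒legsMinimal ls true w 1≤ls minimal
... | 0 | _ | legs = cong (_∧ true) legs
... | 1 | _ | legs = cong (_∧ true) legs
... | suc (suc _) | s≤s () | _
minimalFort⇒spiderCandidate ls 1≤ls (false ∷ w) minimal
  rewrite minimalFort-junctionOut ls w 1≤ls minimal =
  cong (_∧ true) (minimalFort⇒legsMinimal ls false w 1≤ls minimal)

padovan≤numMinimalForts-path : ∀ n → padovan n ≤ numMinimalForts (P (suc n))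
padovan≤numMinimalForts-path zero    = s≤s z≤n
padovan≤numMinimalForts-path (suc L) = begin
  padovan (suc L)
    ≡⟨ countSubsets-legMinimal false true (suc L) ⟨
  countSubsets (suc L) (legMinimal true)
    ≡⟨ +-identityʳ _ ⟨
  countSubsets (suc L) (legMinimal true) + 0
    ≡⟨ cong (countSubsets (suc L) (legMinimal true) +_) (countSubsets-false (suc L)) ⟨
  countSubsets (suc (suc L)) pathCandidate
    ≤⟨ countSubsets≤numMinimalForts (P (suc (suc L))) pathCandidate candidate⇒minimal ⟩
  numMinimalForts (P (suc (suc L))) ∎
  where
  open ≤-Reasoning
  pathCandidate : Subset (suc (suc L)) → Bool
  pathCandidate (b ∷ u) = b ∧ legMinimal true u
  candidate⇒minimal : ∀ F → pathCandidate F ≡ true → IsMinimalFort (P (suc (suc L))) F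
  candidate⇒minimal (true ∷ u) = legMinimal⇒path-minimalFort L u

numMinimalForts-spider≤ : ∀ ls → All (1 ≤_) ls →
  numMinimalForts (Spider ls) ≤ (activeCount true 0 ls + activeCount true 1 ls) + activeCount false 2 ls
numMinimalForts-spider≤ ls 1≤ls = begin
  numMinimalForts (Spider ls)
    ≤⟨ numMinimalForts≤countSubsets (Spider ls) (spiderCandidate ls) (minimalFort⇒spiderCandidate ls 1≤ls) ⟩
  countSubsets (sum ls) (λ w → legs true w ∧ ((active ls w ≡ᵇ 0) ∨ (active ls w ≡ᵇ 1))) + outside₂
    ≡⟨ cong (_+ outside₂) (countSubsets-cong (sum ls) (λ w → ∧-distribˡ-∨ (legs true w) _ _)) ⟩
  countSubsets (sum ls) (λ w → withActive true 0 w ∨ withActive true 1 w) + outside₂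
    ≤⟨ +-monoˡ-≤ outside₂ (countSubsets-∨ (sum ls) (withActive true 0) (withActive true 1)) ⟩
  (countSubsets (sum ls) (withActive true 0) + countSubsets (sum ls) (withActive true 1)) + outside₂
    ≡⟨ cong₂ _+_ (cong₂ _+_ (countSubsets-active true 0 ls 1≤ls) (countSubsets-active true 1 ls 1≤ls))
                 (countSubsets-active false 2 ls 1≤ls) ⟩
  (activeCount true 0 ls + activeCount true 1 ls) + activeCount false 2 ls ∎
  where
  open ≤-Reasoning
  legs : Bool → Subset (sum ls) → Bool
  legs b = allLegs (legMinimal b) ls
  withActive : Bool → ℕ → Subset (sum ls) → Bool
  withActive b c w = legs b w ∧ (active ls w ≡ᵇ c)
  outside₂ = countSubsets (sum ls) (withActive false 2)

-- Padovan estimates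

legPatterns-outside : ∀ n → legPatterns false false n ≡ 1
legPatterns-outside zero    = refl
legPatterns-outside (suc n) = legPatterns-outside n

padovan-≤-suc : ∀ n → padovan n ≤ padovan (suc n)
padovan-≤-suc zero                = ≤-refl
padovan-≤-suc (suc zero)          = ≤-refl
padovan-≤-suc (suc (suc zero))    = s≤s z≤n
padovan-≤-suc (suc (suc (suc n))) = +-mono-≤ (padovan-≤-suc n) (padovan-≤-suc (suc n))

padovan-mono : ∀ {m n} → m ≤ n → padovan m ≤ padovan n
padovan-mono {m} m≤n = go (≤⇒≤′ m≤n)
  where
  go : ∀ {n} → m ≤′ n → padovan m ≤ padovan n
  go ≤′-refl                 = ≤-refl
  go {suc n} (≤′-step m≤′n) = ≤-trans (go m≤′n) (padovan-≤-suc n)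

padovan-pos : ∀ n → 1 ≤ padovan n
padovan-pos n = padovan-mono {0} {n} z≤n

padovan-supermultiplicative : ∀ a b → padovan a * padovan b ≤ padovan (a + b)
padovan-supermultiplicative zero                b = ≤-reflexive (+-identityʳ (padovan b))
padovan-supermultiplicative (suc zero)          b =
  ≤-trans (≤-reflexive (+-identityʳ (padovan b))) (padovan-≤-suc b)
padovan-supermultiplicative (suc (suc zero))    b =
  ≤-trans (≤-reflexive (+-identityʳ (padovan b))) (≤-trans (padovan-≤-suc b) (padovan-≤-suc (suc b)))
padovan-supermultiplicative (suc (suc (suc a))) b = begin
  (padovan a + padovan (suc a)) * padovan b
    ≡⟨ *-distribʳ-+ (padovan b) (padovan a) (padovan (suc a)) ⟩
  padovan a * padovan b + padovan (suc a) * padovan b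
    ≤⟨ +-mono-≤ (padovan-supermultiplicative a b) (padovan-supermultiplicative (suc a) b) ⟩
  padovan (a + b) + padovan (suc (a + b)) ∎
  where open ≤-Reasoning

-- The junction-in patterns of two legs of lengths x + 1 and y + 1: at most one of them is active.
junctionInPairs : ℕ → ℕ → ℕ
junctionInPairs x y =
  legPatterns true false x * legPatterns true false y + legPatterns true false x * legPatterns true true y
    + legPatterns true true x * legPatterns true false y

-- Two legs through the junction form a path; split its minimal forts by the middle vertex.
padovan-split : ∀ x y → padovan x * padovan y + junctionInPairs x y ≡ padovan (suc x + suc y)
padovan-split zero                y = x₀ (padovan y) (legPatterns true false y) (legPatterns true true y)
  where
  x₀ : ∀ h a b → 1 * h + (0 * a + 0 * b + 1 * a) ≡ a + h
  x₀ = solve-∀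
padovan-split (suc zero)          y = x₁ (padovan y) (legPatterns true false y) (legPatterns true true y)
  where
  x₁ : ∀ h a b → 1 * h + (1 * a + 1 * b + 0 * a) ≡ h + (b + a)
  x₁ = solve-∀
padovan-split (suc (suc zero))    y = x₂ (padovan y) (legPatterns true false y) (legPatterns true true y)
  where
  x₂ : ∀ h a b → 1 * h + (1 * a + 1 * b + 1 * a) ≡ (b + a) + (a + h)
  x₂ = solve-∀
padovan-split (suc (suc (suc x))) y = begin
  padovan (3 + x) * padovan y + junctionInPairs (3 + x) y
    ≡⟨ linear (padovan x) (padovan (1 + x)) (out x) (out (1 + x)) (in′ x) (in′ (1 + x))
              (padovan y) (out y) (in′ y) ⟩
  (padovan x * padovan y + junctionInPairs x y) + (padovan (1 + x) * padovan y + junctionInPairs (1 + x) y)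
    ≡⟨ cong₂ _+_ (padovan-split x y) (padovan-split (suc x) y) ⟩
  padovan (4 + x + suc y) ∎
  where
  open ≡-Reasoning
  out in′ : ℕ → ℕ
  out = legPatterns true false
  in′ = legPatterns true true
  linear : ∀ h₀ h₁ a₀ a₁ b₀ b₁ h a b →
    (h₀ + h₁) * h + ((a₀ + a₁) * a + (a₀ + a₁) * b + (b₀ + b₁) * a)
    ≡ (h₀ * h + (a₀ * a + a₀ * b + b₀ * a)) + (h₁ * h + (a₁ * a + a₁ * b + b₁ * a))
  linear = solve-∀

activeCount-outside-none : ∀ ls → All (1 ≤_) ls → activeCount false 0 ls ≡ 1
activeCount-outside-none []          _          = refl
activeCount-outside-none (suc l ∷ ls) (_ ∷ 1≤ls)
  rewrite legPatterns-outside l | activeCount-outside-none ls 1≤ls = refl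

padovan-*-scaled : ∀ x m L → padovan x * (m * padovan L) ≤ m * padovan (x + L)
padovan-*-scaled x m L = begin
  padovan x * (m * padovan L) ≡⟨ x*[m*y]≡m*[x*y] (padovan x) m (padovan L) ⟩
  m * (padovan x * padovan L) ≤⟨ *-monoʳ-≤ m (padovan-supermultiplicative x L) ⟩
  m * padovan (x + L)         ∎
  where
  open ≤-Reasoning
  x*[m*y]≡m*[x*y] : ∀ x m y → x * (m * y) ≡ m * (x * y)
  x*[m*y]≡m*[x*y] = solve-∀

activeCount-outside-≤ : ∀ c ls → All (1 ≤_) ls →
  activeCount false c ls ≤ (length ls C c) * padovan (sum ls)
activeCount-outside-≤ zero    []           _          = ≤-refl
activeCount-outside-≤ (suc c) []           _          = z≤n
activeCount-outside-≤ zero    (l ∷ ls)     1≤l∷ls     =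
  ≤-trans (≤-reflexive (activeCount-outside-none (l ∷ ls) 1≤l∷ls))
          (≤-trans (padovan-pos (sum (l ∷ ls))) (≤-reflexive (sym (+-identityʳ _))))
activeCount-outside-≤ (suc c) (suc x ∷ ls) (_ ∷ 1≤ls) rewrite legPatterns-outside x = begin
  padovan x * activeCount false c ls + 1 * activeCount false (suc c) ls
    ≤⟨ +-mono-≤ (*-monoʳ-≤ (padovan x) (activeCount-outside-≤ c ls 1≤ls))
                (*-monoʳ-≤ 1 (activeCount-outside-≤ (suc c) ls 1≤ls)) ⟩
  padovan x * ((k C c) * padovan L) + 1 * ((k C suc c) * padovan L)
    ≤⟨ +-mono-≤ (≤-trans (padovan-*-scaled x (k C c) L) (*-monoʳ-≤ (k C c) (padovan-≤-suc (x + L))))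
                (≤-trans (≤-reflexive (*-identityˡ _))
                         (*-monoʳ-≤ (k C suc c) (padovan-mono (m≤n+m L (suc x))))) ⟩
  (k C c) * padovan (suc x + L) + (k C suc c) * padovan (suc x + L)
    ≡⟨ *-distribʳ-+ (padovan (suc x + L)) (k C c) (k C suc c) ⟨
  ((k C c) + (k C suc c)) * padovan (suc x + L)
    ≡⟨ cong (_* padovan (suc x + L)) (nCk+nC[k+1]≡[n+1]C[k+1] k c) ⟩
  (suc k C suc c) * padovan (suc x + L) ∎
  where
  open ≤-Reasoning
  k = length ls
  L = sum ls

activeCount-inside-≤ : ∀ ls → All (1 ≤_) ls →
  activeCount true 0 ls + activeCount true 1 ls ≤ padovan (sum ls)
activeCount-inside-≤ []           _          = ≤-refl
activeCount-inside-≤ (suc x ∷ ls) (_ ∷ 1≤ls) = begin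
  out * B₀ + (in′ * B₀ + out * B₁) ≤⟨ expand out in′ B₀ B₁ ⟩
  (in′ + out) * (B₀ + B₁)          ≤⟨ *-monoʳ-≤ (padovan (suc x)) (activeCount-inside-≤ ls 1≤ls) ⟩
  padovan (suc x) * padovan (sum ls) ≤⟨ padovan-supermultiplicative (suc x) (sum ls) ⟩
  padovan (suc x + sum ls)         ∎
  where
  open ≤-Reasoning
  out = legPatterns true false x
  in′ = legPatterns true true x
  B₀ = activeCount true 0 ls
  B₁ = activeCount true 1 ls
  expand : ∀ a b p q → a * p + (b * p + a * q) ≤ (b + a) * (p + q)
  expand a b p q = ≤-trans (m≤m+n _ (b * q)) (≤-reflexive (eq a b p q))
    where
    eq : ∀ a b p q → a * p + (b * p + a * q) + b * q ≡ (b + a) * (p + q)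
    eq = solve-∀

twoLegs-inside : ∀ x y rest →
  activeCount true 0 (suc x ∷ suc y ∷ rest) + activeCount true 1 (suc x ∷ suc y ∷ rest)
  ≤ junctionInPairs x y * (activeCount true 0 rest + activeCount true 1 rest)
twoLegs-inside x y rest =
  ≤-trans (m≤m+n _ (oₓ * iᵧ * B₁ + iₓ * oᵧ * B₁)) (≤-reflexive (expand oₓ iₓ oᵧ iᵧ B₀ B₁))
  where
  oₓ = legPatterns true false x
  iₓ = legPatterns true true x
  oᵧ = legPatterns true false y
  iᵧ = legPatterns true true y
  B₀ = activeCount true 0 rest
  B₁ = activeCount true 1 rest
  expand : ∀ a b c d p q → a * (c * p) + (b * (c * p) + a * (d * p + c * q)) + (a * d * q + b * c * q)
                           ≡ (a * c + a * d + b * c) * (p + q)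
  expand = solve-∀

twoLegs-outside : ∀ x y rest → All (1 ≤_) rest →
  activeCount false 2 (suc x ∷ suc y ∷ rest)
  ≡ activeCount false 2 rest + padovan y * activeCount false 1 rest + padovan x * activeCount false 1 rest
    + padovan x * padovan y
twoLegs-outside x y rest 1≤rest
  rewrite legPatterns-outside x | legPatterns-outside y | activeCount-outside-none rest 1≤rest =
  expand (activeCount false 2 rest) (activeCount false 1 rest) (padovan x) (padovan y)
  where
  expand : ∀ a₂ a₁ hₓ hᵧ →
    hₓ * (hᵧ * 1 + 1 * a₁) + 1 * (hᵧ * a₁ + 1 * a₂) ≡ a₂ + hᵧ * a₁ + hₓ * a₁ + hₓ * hᵧ
  expand = solve-∀

[2+K]C2 : ∀ K → suc (suc K) C 2 ≡ K C 2 + K + K + 1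
[2+K]C2 K = begin
  suc (suc K) C 2           ≡⟨ nCk+nC[k+1]≡[n+1]C[k+1] (suc K) 1 ⟨
  suc K C 1 + suc K C 2     ≡⟨ cong₂ _+_ (nC1≡n (suc K)) (sym (nCk+nC[k+1]≡[n+1]C[k+1] K 1)) ⟩
  suc K + (K C 1 + K C 2)   ≡⟨ cong (λ z → suc K + (z + K C 2)) (nC1≡n K) ⟩
  suc K + (K + K C 2)       ≡⟨ rearrange K (K C 2) ⟩
  K C 2 + K + K + 1         ∎
  where
  open ≡-Reasoning
  rearrange : ∀ a b → suc a + (a + b) ≡ b + a + a + 1
  rearrange = solve-∀

pathThroughJunction-≤ : ∀ x y L B → B ≤ padovan L →
  padovan x * padovan y + junctionInPairs x y * B ≤ padovan (suc x + (suc y + L))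
pathThroughJunction-≤ x y L B B≤ = begin
  Hₓ * Hᵧ + junctionInPairs x y * B
    ≤⟨ +-mono-≤ (≤-trans (≤-reflexive (sym (*-identityʳ (Hₓ * Hᵧ)))) (*-monoʳ-≤ (Hₓ * Hᵧ) (padovan-pos L)))
                (*-monoʳ-≤ (junctionInPairs x y) B≤) ⟩
  Hₓ * Hᵧ * padovan L + junctionInPairs x y * padovan L   ≡⟨ *-distribʳ-+ (padovan L) (Hₓ * Hᵧ) _ ⟨
  (Hₓ * Hᵧ + junctionInPairs x y) * padovan L             ≡⟨ cong (_* padovan L) (padovan-split x y) ⟩
  padovan (suc x + suc y) * padovan L                     ≤⟨ padovan-supermultiplicative (suc x + suc y) L ⟩
  padovan (suc x + suc y + L)                             ≡⟨ cong padovan (+-assoc (suc x) (suc y) L) ⟩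
  padovan (suc x + (suc y + L))                           ∎
  where
  open ≤-Reasoning
  Hₓ = padovan x
  Hᵧ = padovan y

activeCounts-≤ : ∀ ls → 2 ≤ length ls → All (1 ≤_) ls →
  (activeCount true 0 ls + activeCount true 1 ls) + activeCount false 2 ls ≤ (length ls C 2) * padovan (sum ls)
activeCounts-≤ (_ ∷ [])               (s≤s ()) _
activeCounts-≤ (suc x ∷ suc y ∷ rest) _        (_ ∷ _ ∷ 1≤rest) = begin
  (activeCount true 0 ls + activeCount true 1 ls) + activeCount false 2 ls
    ≤⟨ +-mono-≤ (twoLegs-inside x y rest) (≤-reflexive (twoLegs-outside x y rest 1≤rest)) ⟩
  Jₓᵧ * B + (A₂ + Hᵧ * A₁ + Hₓ * A₁ + Hₓ * Hᵧ)
    ≡⟨ rearrange (Jₓᵧ * B) A₂ (Hᵧ * A₁) (Hₓ * A₁) (Hₓ * Hᵧ) ⟩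
  A₂ + Hᵧ * A₁ + Hₓ * A₁ + (Hₓ * Hᵧ + Jₓᵧ * B)
    ≤⟨ +-mono-≤ (+-mono-≤ (+-mono-≤ bound₂ boundᵧ) boundₓ)
                (pathThroughJunction-≤ x y L B (activeCount-inside-≤ rest 1≤rest)) ⟩
  (K C 2) * H + K * H + K * H + H
    ≡⟨ collect (K C 2) K H ⟩
  (K C 2 + K + K + 1) * H
    ≡⟨ cong (_* H) ([2+K]C2 K) ⟨
  (suc (suc K) C 2) * H ∎
  where
  open ≤-Reasoning
  ls = suc x ∷ suc y ∷ rest
  K = length rest
  L = sum rest
  H = padovan (suc x + (suc y + L))
  Hₓ = padovan x
  Hᵧ = padovan y
  Jₓᵧ = junctionInPairs x y
  B = activeCount true 0 rest + activeCount true 1 rest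
  A₂ = activeCount false 2 rest
  A₁ = activeCount false 1 rest
  rearrange : ∀ a b c d e → a + (b + c + d + e) ≡ b + c + d + (e + a)
  rearrange = solve-∀
  collect : ∀ c k h → c * h + k * h + k * h + h ≡ (c + k + k + 1) * h
  collect = solve-∀
  bound₂ : A₂ ≤ (K C 2) * H
  bound₂ = ≤-trans (activeCount-outside-≤ 2 rest 1≤rest)
                   (*-monoʳ-≤ (K C 2) (padovan-mono (≤-trans (m≤n+m L (suc y)) (m≤n+m (suc y + L) (suc x)))))
  A₁≤ : A₁ ≤ K * padovan L
  A₁≤ = subst (λ z → A₁ ≤ z * padovan L) (nC1≡n K) (activeCount-outside-≤ 1 rest 1≤rest)
  boundᵧ : Hᵧ * A₁ ≤ K * H
  boundᵧ = ≤-trans (*-monoʳ-≤ Hᵧ A₁≤) (≤-trans (padovan-*-scaled y K L)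
                   (*-monoʳ-≤ K (padovan-mono (≤-trans (n≤1+n (y + L)) (m≤n+m (suc y + L) (suc x))))))
  boundₓ : Hₓ * A₁ ≤ K * H
  boundₓ = ≤-trans (*-monoʳ-≤ Hₓ A₁≤) (≤-trans (padovan-*-scaled x K L)
                   (*-monoʳ-≤ K (padovan-mono (≤-trans (+-monoʳ-≤ x (m≤n+m L (suc y))) (n≤1+n _)))))

theorem4p13 : (ls : List ℕ) → 2 ≤ length ls → All (1 ≤_) ls →
    numMinimalForts (Spider ls) ≤ (length ls C 2) * numMinimalForts (P (suc (sum ls)))
theorem4p13 ls 2≤k 1≤ls = begin
  numMinimalForts (Spider ls)
    ≤⟨ numMinimalForts-spider≤ ls 1≤ls ⟩
  (activeCount true 0 ls + activeCount true 1 ls) + activeCount false 2 ls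
    ≤⟨ activeCounts-≤ ls 2≤k 1≤ls ⟩
  (length ls C 2) * padovan (sum ls)
    ≤⟨ *-monoʳ-≤ (length ls C 2) (padovan≤numMinimalForts-path (sum ls)) ⟩
  (length ls C 2) * numMinimalForts (P (suc (sum ls))) ∎
  where open ≤-Reasoning
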